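{- For integers $n_1,n_2\ge 2$, let $g_{n_1,n_2}$ denote the number of standard Young tableaux of truncated shifted shape with $n_1$ rows and $n_2$ boxes in each row, and set by convention $g_{3,1}:=1$. Then for all $n\ge 1$, $$g_{3,n+1}=-g_{3,n}+\frac{7n+1}{n^2(n+1)^2}\binom{2n-2}{n-1}\binom{3n}{n-1}.$$
   Context: The truncated shifted shape with $n_1$ rows and $n_2$ boxes in each row is the set of boxes $(i,c)$ with $1\le i\le n_1$ and $i\le c\le i+n_2-1$ (row $i$ consists of $n_2$ consecutive boxes starting in column $i$); equivalently it is the shifted diagram of $(n_1+n_2-1,n_1+n_2-2,\dots,n_2)$ with the staircase $(n_1-1,\dots,1)$ removed from its north-east corner. A standard Young tableau of this shape is a bijective labeling of its $n_1n_2$ boxes by $\{1,2,\dots,n_1n_2\}$ such that labels increase from left to right along each row and from top to bottom along each column. -}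

module Defs where

open import Data.Nat using (ℕ; zero; suc; _+_; _*_; _∸_; _≤_; _<_; _≟_; _≤?_; _<?_)
open import Data.Nat.Combinatorics using (_C_)
open import Data.Fin using (Fin; toℕ)
open import Data.Fin.Properties using (all?; any?) renaming (_≟_ to _≟ᶠ_)
open import Data.Vec using (Vec; []; _∷_; lookup)
open import Data.List using (List; []; _∷_; [_]; map; concatMap; upTo; filter; length)
open import Data.Product using (_×_; _,_; ∃)
open import Data.Product.Properties using (≡-dec)
open import Relation.Binary.PropositionalEquality using (_≡_)
open import Relation.Nullary using (Dec; yes; no)
open import Relation.Nullary.Decidable using (_×-dec_; _→-dec_)

-- Row i (0-indexed, i : Fin n₁) consists of the boxes in columns i, i+1, …, i+n₂-1;
-- the box of row i in column (toℕ i + toℕ j) is stored at position j : Fin n₂.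
-- (0-indexed rows/columns; this is the paper's shape shifted by one in both coordinates.)
Labeling : ℕ → ℕ → Set
Labeling n₁ n₂ = Vec (Vec ℕ n₂) n₁

Box : ℕ → ℕ → Set
Box n₁ n₂ = Fin n₁ × Fin n₂

row : ∀ {n₁ n₂} → Box n₁ n₂ → ℕ
row (i , j) = toℕ i

col : ∀ {n₁ n₂} → Box n₁ n₂ → ℕ
col (i , j) = toℕ i + toℕ j

entry : ∀ {n₁ n₂} → Labeling n₁ n₂ → Box n₁ n₂ → ℕ
entry T (i , j) = lookup (lookup T i) j

record IsSYT {n₁ n₂ : ℕ} (T : Labeling n₁ n₂) : Set where
  field
    range      : ∀ (b : Box n₁ n₂) → 1 ≤ entry T b × entry T b ≤ n₁ * n₂
    injective  : ∀ (b b′ : Box n₁ n₂) → entry T b ≡ entry T b′ → b ≡ b′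
    surjective : ∀ (k : Fin (n₁ * n₂)) → ∃ λ (b : Box n₁ n₂) → entry T b ≡ suc (toℕ k)
    rowInc     : ∀ (b b′ : Box n₁ n₂) → row b ≡ row b′ → col b < col b′ → entry T b < entry T b′
    colInc     : ∀ (b b′ : Box n₁ n₂) → col b ≡ col b′ → row b < row b′ → entry T b < entry T b′

private
  allBox? : ∀ {n₁ n₂} {P : Box n₁ n₂ → Set} → (∀ b → Dec (P b)) → Dec (∀ b → P b)
  allBox? {P = P} P? with all? (λ i → all? (λ j → P? (i , j)))
  ... | yes p = yes (λ { (i , j) → p i j })
  ... | no ¬p = no (λ p → ¬p (λ i j → p (i , j)))

  anyBox? : ∀ {n₁ n₂} {P : Box n₁ n₂ → Set} → (∀ b → Dec (P b)) → Dec (∃ P)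
  anyBox? {P = P} P? with any? (λ i → any? (λ j → P? (i , j)))
  ... | yes (i , j , p) = yes ((i , j) , p)
  ... | no ¬p = no (λ { ((i , j) , p) → ¬p (i , j , p) })

  _≟ᵇ_ : ∀ {n₁ n₂} (b b′ : Box n₁ n₂) → Dec (b ≡ b′)
  _≟ᵇ_ = ≡-dec _≟ᶠ_ _≟ᶠ_

isSYT? : ∀ {n₁ n₂} (T : Labeling n₁ n₂) → Dec (IsSYT T)
isSYT? {n₁} {n₂} T with allBox? (λ b → (1 ≤? entry T b) ×-dec (entry T b ≤? n₁ * n₂))
                     | allBox? (λ b → allBox? (λ b′ → (entry T b ≟ entry T b′) →-dec (b ≟ᵇ b′)))
                     | all? (λ k → anyBox? (λ b → entry T b ≟ suc (toℕ k)))
                     | allBox? (λ b → allBox? (λ b′ → (row b ≟ row b′) →-dec ((col b <? col b′) →-dec (entry T b <? entry T b′))))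
                     | allBox? (λ b → allBox? (λ b′ → (col b ≟ col b′) →-dec ((row b <? row b′) →-dec (entry T b <? entry T b′))))
... | yes a | yes b | yes c | yes d | yes e = yes record { range = a ; injective = b ; surjective = c ; rowInc = d ; colInc = e }
... | no ¬a | _ | _ | _ | _ = no (λ t → ¬a (IsSYT.range t))
... | yes _ | no ¬a | _ | _ | _ = no (λ t → ¬a (IsSYT.injective t))
... | yes _ | yes _ | no ¬a | _ | _ = no (λ t → ¬a (IsSYT.surjective t))
... | yes _ | yes _ | yes _ | no ¬a | _ = no (λ t → ¬a (IsSYT.rowInc t))
... | yes _ | yes _ | yes _ | yes _ | no ¬a = no (λ t → ¬a (IsSYT.colInc t))

vecsOver : ∀ {A : Set} (k : ℕ) → List A → List (Vec A k)
vecsOver zero xs = [ [] ]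
vecsOver (suc k) xs = concatMap (λ x → map (x ∷_) (vecsOver k xs)) xs

labelings : (n₁ n₂ : ℕ) → List (Labeling n₁ n₂)
labelings n₁ n₂ = vecsOver n₁ (vecsOver n₂ (map suc (upTo (n₁ * n₂))))

g : ℕ → ℕ → ℕ
g n₁ n₂ = length (filter isSYT? (labelings n₁ n₂))

g₃ : ℕ → ℕ
g₃ 1 = 1
g₃ n = g 3 n

module Submission where

-- Fill the boxes of the shape in increasing order of their labels.  At
-- each stage the filled boxes of row i are its first hᵢ boxes, and the largest
-- label sits at the end of a row with nothing filled below it.  Hence the number
-- cnt a b c of fillings of the rows to lengths a, b, c obeys a three-term
-- recursion, in which a term is present exactly when the last box of its row is a
-- corner.
--   1. Generic counting lemmas for filtered lists (bijections, disjoint unions).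
--   2. The recursion cnt and its corner conditions.
--   3. g 3 N ≡ cnt N N N: deleting the largest label is a bijection between the
--      fillings with largest label in row i and the fillings of the shorter shape.
--   4. For strict shapes a > b > c, cnt is the shifted hook-length product.
--   5. In the square shape the last boxes of rows 0 and 1 are blocked, so
--      g₃(n+1) + g₃(n) is a sum of hook products; its partial sums have a closed
--      form (a Gosper-type certificate), proved by induction on the number of terms.
--   6. Converting factorials to binomial coefficients gives theorem1.

open import Data.Nat using (ℕ; zero; suc; _+_; _*_; _∸_; _≤_; _<_; z≤n; s≤s; z<s; _≟_; _≤?_; _<?_; _!; NonZero)
open import Data.Nat.Properties
open import Data.Nat.DivMod using (m/n*n≡m)
open import Data.Nat.Combinatorics using (_C_; nCk≡n!/k![n-k]!; k![n∸k]!∣n!)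
open import Data.Nat.Tactic.RingSolver using (solve-∀)
open import Data.Fin using (Fin; zero; suc; toℕ; fromℕ<)
open import Data.Fin.Properties using (all?; any?; toℕ<n; toℕ-injective; toℕ-fromℕ<) renaming (_≟_ to _≟ᶠ_)
open import Data.Vec using (Vec; []; _∷_; lookup; tabulate)
import Data.Vec as Vec
open import Data.Vec.Properties using (∷-injective; lookup∘tabulate; tabulate∘lookup; tabulate-cong)
open import Data.List using (List; []; _∷_; length; filter; map; upTo; cartesianProductWith; concatMap; _++_)
open import Data.List.Properties using (length-map; map-∘; map-id-local; filter-none)
open import Data.List.Membership.Propositional using (_∈_)
open import Data.List.Membership.Propositional.Properties using (∈-map⁺; ∈-map⁻; ∈-filter⁺; ∈-filter⁻; ∈-cartesianProductWith⁺; ∈-upTo⁺)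
open import Data.List.Membership.Propositional.Properties.WithK using (unique∧set⇒bag)
open import Data.List.Relation.Binary.BagAndSetEquality using (∼bag⇒↭)
open import Data.List.Relation.Binary.Permutation.Propositional.Properties using (↭-length)
open import Data.List.Relation.Unary.All using ([]; _∷_)
import Data.List.Relation.Unary.All as All
open import Data.List.Relation.Unary.AllPairs using ([]; _∷_)
open import Data.List.Relation.Unary.Any using (here)
open import Data.List.Relation.Unary.Unique.Propositional using (Unique)
import Data.List.Relation.Unary.Unique.Propositional.Properties as Unique
open import Data.Product using (_×_; _,_; proj₁; proj₂; ∃)
open import Data.Product.Properties using (≡-dec)
open import Data.Sum using (_⊎_; inj₁; inj₂; [_,_])
open import Data.Unit using (tt)
open import Data.Empty using (⊥; ⊥-elim)
open import Function using (_∘_; _⇔_; mk⇔)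
open import Relation.Nullary using (¬_; Dec; yes; no)
open import Relation.Nullary.Decidable using (_×-dec_; _⊎-dec_; _→-dec_; ¬?)
open import Relation.Unary using (Decidable)
open import Relation.Binary.PropositionalEquality hiding ([_])
open import Defs

length-unique-sameMembers : {A : Set} {xs ys : List A} → Unique xs → Unique ys →
  (∀ {z} → z ∈ xs ⇔ z ∈ ys) → length xs ≡ length ys
length-unique-sameMembers ux uy same = ↭-length (∼bag⇒↭ (unique∧set⇒bag ux uy same))

count-bijection : {A B : Set} {P : A → Set} {Q : B → Set} (P? : Decidable P) (Q? : Decidable Q) (xs : List A) (ys : List B)
  (f : A → B) (h : B → A) → Unique xs → Unique ys →
  (∀ x → x ∈ xs → P x → Q (f x) × f x ∈ ys × h (f x) ≡ x) →
  (∀ y → y ∈ ys → Q y → P (h y) × h y ∈ xs × f (h y) ≡ y) →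
  length (filter P? xs) ≡ length (filter Q? ys)
count-bijection {A} P? Q? xs ys f h ux uy fwd bwd = begin
    length Ps               ≡⟨ length-map f Ps ⟨
    length (map f Ps)       ≡⟨ length-unique-sameMembers unique-fPs (Unique.filter⁺ Q? uy) (mk⇔ to from) ⟩
    length (filter Q? ys)   ∎
  where
  open ≡-Reasoning
  Ps : List A
  Ps = filter P? xs
  hf-on-Ps : map h (map f Ps) ≡ Ps
  hf-on-Ps = trans (sym (map-∘ Ps)) (map-id-local (All.tabulate λ x∈ →
    let (x∈xs , px) = ∈-filter⁻ P? x∈ in proj₂ (proj₂ (fwd _ x∈xs px))))
  unique-fPs : Unique (map f Ps)
  unique-fPs = Unique.map⁻ (subst Unique (sym hf-on-Ps) (Unique.filter⁺ P? ux))
  to : ∀ {z} → z ∈ map f Ps → z ∈ filter Q? ys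
  to z∈ with ∈-map⁻ f z∈
  ... | x , x∈ , refl = let (x∈xs , px) = ∈-filter⁻ P? x∈ ; (qfx , fx∈ , _) = fwd x x∈xs px
                        in ∈-filter⁺ Q? fx∈ qfx
  from : ∀ {z} → z ∈ filter Q? ys → z ∈ map f Ps
  from {z} z∈ = let (z∈ys , qz) = ∈-filter⁻ Q? z∈ ; (phz , hz∈ , fhz) = bwd z z∈ys qz
                in subst (_∈ map f Ps) fhz (∈-map⁺ f (∈-filter⁺ P? hz∈ phz))

count-none : {A : Set} {P : A → Set} (P? : Decidable P) (xs : List A) → (∀ x → ¬ P x) → length (filter P? xs) ≡ 0
count-none P? xs none = cong length (filter-none P? {xs} (All.tabulate λ {x} _ → none x))

count-⊎ : {A : Set} {P Q Q′ : A → Set} (P? : Decidable P) (Q? : Decidable Q) (Q′? : Decidable Q′) (xs : List A) →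
  (∀ {x} → P x → Q x ⊎ Q′ x) → (∀ {x} → Q x ⊎ Q′ x → P x) → (∀ {x} → Q x → Q′ x → ⊥) →
  length (filter P? xs) ≡ length (filter Q? xs) + length (filter Q′? xs)
count-⊎ P? Q? Q′? [] split join disj = refl
count-⊎ P? Q? Q′? (x ∷ xs) split join disj with ih ← count-⊎ P? Q? Q′? xs split join disj | P? x | Q? x | Q′? x
... | yes _ | yes q | yes r = ⊥-elim (disj q r)
... | yes _ | yes _ | no _  = cong suc ih
... | yes _ | no _  | yes _ = trans (cong suc ih) (sym (+-suc _ _))
... | yes p | no ¬q | no ¬r = ⊥-elim ([ ¬q , ¬r ] (split p))
... | no ¬p | yes q | _     = ⊥-elim (¬p (join (inj₁ q)))
... | no ¬p | no _  | yes r = ⊥-elim (¬p (join (inj₂ r)))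
... | no _  | no _  | no _  = ih

vecsOver-suc : {A : Set} → ∀ k (xs : List A) → vecsOver (suc k) xs ≡ cartesianProductWith _∷_ xs (vecsOver k xs)
vecsOver-suc k xs = prepend-each xs
  where
  prepend-each : ∀ ys → concatMap (λ y → map (y ∷_) (vecsOver k xs)) ys ≡ cartesianProductWith _∷_ ys (vecsOver k xs)
  prepend-each [] = refl
  prepend-each (y ∷ ys) = cong (map (y ∷_) (vecsOver k xs) ++_) (prepend-each ys)

vecsOver-unique : {A : Set} → ∀ k {xs : List A} → Unique xs → Unique (vecsOver k xs)
vecsOver-unique zero _ = [] ∷ []
vecsOver-unique (suc k) {xs} u = subst Unique (sym (vecsOver-suc k xs))
  (Unique.cartesianProductWith⁺ _∷_ ∷-injective u (vecsOver-unique k u))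

vecsOver-complete : {A : Set} → ∀ k {xs : List A} (v : Vec A k) → (∀ i → lookup v i ∈ xs) → v ∈ vecsOver k xs
vecsOver-complete zero [] _ = here refl
vecsOver-complete (suc k) {xs} (y ∷ v) h = subst (y ∷ v ∈_) (sym (vecsOver-suc k xs))
  (∈-cartesianProductWith⁺ _∷_ (h zero) (vecsOver-complete k v (h ∘ suc)))

when : {P : Set} → Dec P → ℕ → ℕ
when (yes _) n = n
when (no _) _ = 0

when-yes : {P : Set} (d : Dec P) {n : ℕ} → P → when d n ≡ n
when-yes (yes _) _ = refl
when-yes (no ¬p) p = ⊥-elim (¬p p)

when-no : {P : Set} (d : Dec P) {n : ℕ} → ¬ P → when d n ≡ 0
when-no (yes p) ¬p = ⊥-elim (¬p p)
when-no (no _) _ = refl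

-- The last filled box of row 0, when row 0 has a + 1 filled boxes, sits in
-- column a; below it lie box a - 1 of row 1 and box a - 2 of row 2.  It is a
-- corner (may hold the largest entry) iff neither of these is filled.
Corner₀ : ℕ → ℕ → ℕ → Set
Corner₀ a b c = (a ≡ 0 ⊎ b < a) × (a ≤ 1 ⊎ suc c < a)

corner₀? : ∀ a b c → Dec (Corner₀ a b c)
corner₀? a b c = ((a ≟ 0) ⊎-dec (b <? a)) ×-dec ((a ≤? 1) ⊎-dec (suc c <? a))

-- Likewise the last filled box of row 1 (box b, column b + 1, when row 1 has
-- b + 1 filled boxes) is a corner iff box b - 1 of row 2 is not filled.
Corner₁ : ℕ → ℕ → Set
Corner₁ b c = b ≡ 0 ⊎ c < b

corner₁? : ∀ b c → Dec (Corner₁ b c)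
corner₁? b c = (b ≟ 0) ⊎-dec (c <? b)

blocked₀ : ∀ {a b c} → (0 < a × a ≤ b) ⊎ (1 < a × a ≤ suc c) → ¬ Corner₀ a b c
blocked₀ (inj₁ (0<a , _))   (inj₁ refl , _)    = <-irrefl refl 0<a
blocked₀ (inj₁ (_ , a≤b))   (inj₂ b<a , _)     = <⇒≱ b<a a≤b
blocked₀ (inj₂ (1<a , _))   (_ , inj₁ a≤1)     = <⇒≱ 1<a a≤1
blocked₀ (inj₂ (_ , a≤1+c)) (_ , inj₂ 1+c<a)   = <⇒≱ 1+c<a a≤1+c

blocked₁ : ∀ {b c} → 0 < b → b ≤ c → ¬ Corner₁ b c
blocked₁ 0<b _   (inj₁ refl) = <-irrefl refl 0<b
blocked₁ _   b≤c (inj₂ c<b)  = <⇒≱ c<b b≤c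

¬corner₀⇒blocked : ∀ a b c → ¬ Corner₀ a b c → (0 < a × a ≤ b) ⊎ (1 < a × a ≤ suc c)
¬corner₀⇒blocked zero b c ¬corner = ⊥-elim (¬corner (inj₁ refl , inj₁ z≤n))
¬corner₀⇒blocked (suc a) b c ¬corner with b <? suc a | suc c <? suc a
... | no b≮a | _ = inj₁ (s≤s z≤n , ≮⇒≥ b≮a)
... | yes b<a | yes c<a = ⊥-elim (¬corner (inj₂ b<a , inj₂ c<a))
... | yes b<a | no c≮a with a
...   | zero = ⊥-elim (¬corner (inj₂ b<a , inj₁ (s≤s z≤n)))
...   | suc a′ = inj₂ (s≤s (s≤s z≤n) , ≮⇒≥ c≮a)

¬corner₁⇒blocked : ∀ b c → ¬ Corner₁ b c → 0 < b × b ≤ c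
¬corner₁⇒blocked zero c ¬corner = ⊥-elim (¬corner (inj₁ refl))
¬corner₁⇒blocked (suc b) c ¬corner with c <? suc b
... | yes c<b = ⊥-elim (¬corner (inj₂ c<b))
... | no c≮b = s≤s z≤n , ≮⇒≥ c≮b

-- cnt a b c: the number of fillings of the three rows filled to lengths a, b, c
-- (row i starting in column i), by recursion on where the largest entry sits.
mutual
  cnt : ℕ → ℕ → ℕ → ℕ
  cnt a b c = emptyShape a b c + viaRow₀ a b c + viaRow₁ a b c + viaRow₂ a b c

  emptyShape : ℕ → ℕ → ℕ → ℕ
  emptyShape zero zero zero = 1
  emptyShape _ _ _ = 0

  viaRow₀ : ℕ → ℕ → ℕ → ℕ
  viaRow₀ zero b c = 0
  viaRow₀ (suc a) b c = when (corner₀? a b c) (cnt a b c)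

  viaRow₁ : ℕ → ℕ → ℕ → ℕ
  viaRow₁ a zero c = 0
  viaRow₁ a (suc b) c = when (corner₁? b c) (cnt a b c)

  -- the last box of row 2 has nothing below it
  viaRow₂ : ℕ → ℕ → ℕ → ℕ
  viaRow₂ a b zero = 0
  viaRow₂ a b (suc c) = cnt a b c

cnt-oneRow : ∀ a → cnt a 0 0 ≡ 1
cnt-oneRow zero = refl
cnt-oneRow (suc a) = begin
    cnt (suc a) 0 0        ≡⟨ trans (+-identityʳ _) (+-identityʳ _) ⟩
    viaRow₀ (suc a) 0 0    ≡⟨ when-yes (corner₀? a 0 0) (corner a) ⟩
    cnt a 0 0              ≡⟨ cnt-oneRow a ⟩
    1                      ∎
  where
  open ≡-Reasoning
  corner : ∀ a → Corner₀ a 0 0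
  corner zero = inj₁ refl , inj₁ z≤n
  corner (suc zero) = inj₂ (s≤s z≤n) , inj₁ (s≤s z≤n)
  corner (suc (suc a)) = inj₂ (s≤s z≤n) , inj₂ (s≤s (s≤s z≤n))

viaRow₀-corner : ∀ a b c → Corner₀ a b c → viaRow₀ (suc a) b c ≡ cnt a b c
viaRow₀-corner a b c = when-yes (corner₀? a b c)

viaRow₀-blocked : ∀ a b c → (0 < a × a ≤ b) ⊎ (1 < a × a ≤ suc c) → viaRow₀ (suc a) b c ≡ 0
viaRow₀-blocked a b c below = when-no (corner₀? a b c) (blocked₀ below)

viaRow₁-corner : ∀ a b c → Corner₁ b c → viaRow₁ a (suc b) c ≡ cnt a b c
viaRow₁-corner a b c = when-yes (corner₁? b c)

viaRow₁-blocked : ∀ a b c → 0 < b → b ≤ c → viaRow₁ a (suc b) c ≡ 0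
viaRow₁-blocked a b c 0<b b≤c = when-no (corner₁? b c) (blocked₁ 0<b b≤c)

viaRow₁-shorter : ∀ a b c → viaRow₁ a (suc (suc b)) c ≡ when (c <? suc b) (cnt a (suc b) c)
viaRow₁-shorter a b c with corner₁? (suc b) c | c <? suc b
... | yes _ | yes _ = refl
... | no _ | no _ = refl
... | yes (inj₂ c<b) | no c≮b = ⊥-elim (c≮b c<b)
... | no ¬corner | yes c<b = ⊥-elim (¬corner (inj₂ c<b))

module ThreeRows (N : ℕ) where

  Heights : Set
  Heights = Fin 3 → ℕ

  heights : ℕ → ℕ → ℕ → Heights
  heights a b c zero = a
  heights a b c (suc zero) = b
  heights a b c (suc (suc zero)) = c

  size : Heights → ℕ
  size s = Vec.sum (tabulate s)

  Bounded : Heights → Set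
  Bounded s = ∀ i → s i ≤ N

  Cell : Set
  Cell = Box 3 N

  Label : Set
  Label = Labeling 3 N

  _≟ᶜ_ : (x y : Cell) → Dec (x ≡ y)
  _≟ᶜ_ = ≡-dec _≟ᶠ_ _≟ᶠ_

  allCells? : {P : Cell → Set} → (∀ x → Dec (P x)) → Dec (∀ x → P x)
  allCells? P? with all? (λ i → all? (λ j → P? (i , j)))
  ... | yes p = yes (λ { (i , j) → p i j })
  ... | no ¬p = no (λ p → ¬p (λ i j → p (i , j)))

  anyCell? : {P : Cell → Set} → (∀ x → Dec (P x)) → Dec (∃ P)
  anyCell? P? with any? (λ i → any? (λ j → P? (i , j)))
  ... | yes (i , j , p) = yes ((i , j) , p)
  ... | no ¬p = no (λ { ((i , j) , p) → ¬p (i , j , p) })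

  Filled : Heights → Cell → Set
  Filled s (i , j) = toℕ j < s i

  filled? : ∀ s x → Dec (Filled s x)
  filled? s (i , j) = toℕ j <? s i

  record IsFilling (s : Heights) (T : Label) : Set where
    field
      unfilled   : ∀ x → ¬ Filled s x → entry T x ≡ 0
      range      : ∀ x → Filled s x → 1 ≤ entry T x × entry T x ≤ size s
      injective  : ∀ x y → Filled s x → Filled s y → entry T x ≡ entry T y → x ≡ y
      surjective : ∀ (k : Fin (size s)) → ∃ λ x → Filled s x × entry T x ≡ suc (toℕ k)
      rowInc     : ∀ x y → Filled s x → Filled s y → row x ≡ row y → col x < col y → entry T x < entry T y
      colInc     : ∀ x y → Filled s x → Filled s y → col x ≡ col y → row x < row y → entry T x < entry T y

  isFilling? : ∀ s T → Dec (IsFilling s T)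
  isFilling? s T
    with allCells? (λ x → ¬? (filled? s x) →-dec (entry T x ≟ 0))
       | allCells? (λ x → filled? s x →-dec ((1 ≤? entry T x) ×-dec (entry T x ≤? size s)))
       | allCells? (λ x → allCells? (λ y → filled? s x →-dec (filled? s y →-dec ((entry T x ≟ entry T y) →-dec (x ≟ᶜ y)))))
       | all? (λ k → anyCell? (λ x → filled? s x ×-dec (entry T x ≟ suc (toℕ k))))
       | allCells? (λ x → allCells? (λ y → filled? s x →-dec (filled? s y →-dec ((row x ≟ row y) →-dec ((col x <? col y) →-dec (entry T x <? entry T y))))))
       | allCells? (λ x → allCells? (λ y → filled? s x →-dec (filled? s y →-dec ((col x ≟ col y) →-dec ((row x <? row y) →-dec (entry T x <? entry T y))))))
  ... | yes a | yes b | yes c | yes d | yes e | yes f = yes record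
        { unfilled = a ; range = b ; injective = c ; surjective = d ; rowInc = e ; colInc = f }
  ... | no ¬a | _ | _ | _ | _ | _ = no (λ t → ¬a (IsFilling.unfilled t))
  ... | yes _ | no ¬b | _ | _ | _ | _ = no (λ t → ¬b (IsFilling.range t))
  ... | yes _ | yes _ | no ¬c | _ | _ | _ = no (λ t → ¬c (IsFilling.injective t))
  ... | yes _ | yes _ | yes _ | no ¬d | _ | _ = no (λ t → ¬d (IsFilling.surjective t))
  ... | yes _ | yes _ | yes _ | yes _ | no ¬e | _ = no (λ t → ¬e (IsFilling.rowInc t))
  ... | yes _ | yes _ | yes _ | yes _ | yes _ | no ¬f = no (λ t → ¬f (IsFilling.colInc t))

  candidates : List Label
  candidates = vecsOver 3 (vecsOver N (upTo (suc (3 * N))))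

  candidates-unique : Unique candidates
  candidates-unique = vecsOver-unique 3 (vecsOver-unique N (Unique.upTo⁺ (suc (3 * N))))

  candidates-complete : ∀ (T : Label) → (∀ x → entry T x ≤ 3 * N) → T ∈ candidates
  candidates-complete T bound = vecsOver-complete 3 T (λ i → vecsOver-complete N (lookup T i) (λ j → ∈-upTo⁺ (s≤s (bound (i , j)))))

  size-bounded : ∀ s → Bounded s → size s ≤ 3 * N
  size-bounded s bnd = +-mono-≤ (bnd zero) (+-mono-≤ (bnd (suc zero)) (+-mono-≤ (bnd (suc (suc zero))) z≤n))

  filling∈candidates : ∀ {s T} → Bounded s → IsFilling s T → T ∈ candidates
  filling∈candidates {s} {T} bnd t = candidates-complete T bound
    where
    bound : ∀ x → entry T x ≤ 3 * N
    bound x with filled? s x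
    ... | yes fx = ≤-trans (proj₂ (IsFilling.range t x fx)) (size-bounded s bnd)
    ... | no ¬fx = subst (_≤ 3 * N) (sym (IsFilling.unfilled t x ¬fx)) z≤n

  fillings : Heights → ℕ
  fillings s = length (filter (isFilling? s) candidates)

  full : Heights
  full = heights N N N

  allFilled : ∀ x → Filled full x
  allFilled (zero , j) = toℕ<n j
  allFilled (suc zero , j) = toℕ<n j
  allFilled (suc (suc zero) , j) = toℕ<n j

  g≡fillings-full : g 3 N ≡ fillings full
  g≡fillings-full = count-bijection isSYT? (isFilling? full) (labelings 3 N) candidates (λ T → T) (λ T → T)
    (vecsOver-unique 3 (vecsOver-unique N (Unique.map⁺ suc-injective (Unique.upTo⁺ (3 * N))))) candidates-unique
    syt⇒filling filling⇒syt
    where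
    syt⇒filling : ∀ T → T ∈ labelings 3 N → IsSYT T → IsFilling full T × T ∈ candidates × T ≡ T
    syt⇒filling T _ t = filling , filling∈candidates (λ { zero → ≤-refl ; (suc zero) → ≤-refl ; (suc (suc zero)) → ≤-refl }) filling , refl
      where
      filling : IsFilling full T
      filling = record
        { unfilled = λ x ¬fx → ⊥-elim (¬fx (allFilled x))
        ; range = λ x _ → IsSYT.range t x
        ; injective = λ x y _ _ → IsSYT.injective t x y
        ; surjective = λ k → let (x , e) = IsSYT.surjective t k in x , allFilled x , e
        ; rowInc = λ x y _ _ → IsSYT.rowInc t x y
        ; colInc = λ x y _ _ → IsSYT.colInc t x y }
    positive∈ : ∀ e → 1 ≤ e → e ≤ 3 * N → e ∈ map suc (upTo (3 * N))
    positive∈ (suc e) _ e≤ = ∈-map⁺ suc (∈-upTo⁺ e≤)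
    filling⇒syt : ∀ T → T ∈ candidates → IsFilling full T → IsSYT T × T ∈ labelings 3 N × T ≡ T
    filling⇒syt T _ f = syt , vecsOver-complete 3 T (λ i → vecsOver-complete N (lookup T i) (λ j → labelled (i , j))) , refl
      where
      open IsFilling f
      syt : IsSYT T
      syt = record
        { range = λ x → range x (allFilled x)
        ; injective = λ x y → injective x y (allFilled x) (allFilled y)
        ; surjective = λ k → let (x , _ , e) = surjective k in x , e
        ; rowInc = λ x y → rowInc x y (allFilled x) (allFilled y)
        ; colInc = λ x y → colInc x y (allFilled x) (allFilled y) }
      labelled : ∀ x → entry T x ∈ map suc (upTo (3 * N))
      labelled x = let (1≤e , e≤) = range x (allFilled x) in positive∈ (entry T x) 1≤e e≤

  labelling : (Cell → ℕ) → Label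
  labelling f = tabulate λ i → tabulate λ j → f (i , j)

  entry-labelling : ∀ f x → entry (labelling f) x ≡ f x
  entry-labelling f (i , j) = trans (cong (λ r → lookup r j) (lookup∘tabulate (λ i → tabulate λ j → f (i , j)) i)) (lookup∘tabulate (λ j → f (i , j)) j)

  labelling-ext : ∀ (T U : Label) → (∀ x → entry T x ≡ entry U x) → T ≡ U
  labelling-ext T U same = vec-ext (λ i → vec-ext (λ j → same (i , j)))
    where
    vec-ext : ∀ {A : Set} {n} {xs ys : Vec A n} → (∀ i → lookup xs i ≡ lookup ys i) → xs ≡ ys
    vec-ext {xs = xs} {ys} h = trans (sym (tabulate∘lookup xs)) (trans (tabulate-cong h) (tabulate∘lookup ys))

  replaceAt : Label → Cell → ℕ → Cell → ℕ
  replaceAt T x v y with y ≟ᶜ x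
  ... | yes _ = v
  ... | no _ = entry T y

  _[_]≔_ : Label → Cell → ℕ → Label
  T [ x ]≔ v = labelling (replaceAt T x v)

  entry-≔-here : ∀ T x v → entry (T [ x ]≔ v) x ≡ v
  entry-≔-here T x v = trans (entry-labelling (replaceAt T x v) x) replaced
    where
    replaced : replaceAt T x v x ≡ v
    replaced with x ≟ᶜ x
    ... | yes _ = refl
    ... | no x≢x = ⊥-elim (x≢x refl)

  entry-≔-elsewhere : ∀ T x v y → y ≢ x → entry (T [ x ]≔ v) y ≡ entry T y
  entry-≔-elsewhere T x v y y≢x = trans (entry-labelling (replaceAt T x v) y) elsewhere
    where
    elsewhere : replaceAt T x v y ≡ entry T y
    elsewhere with y ≟ᶜ x
    ... | yes y≡x = ⊥-elim (y≢x y≡x)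
    ... | no _ = refl

  fillings-empty : fillings (heights 0 0 0) ≡ 1
  fillings-empty = count-bijection (isFilling? (heights 0 0 0)) (λ _ → yes tt) candidates (tt ∷ []) (λ _ → tt) (λ _ → zeros)
    candidates-unique ([] ∷ [])
    (λ T _ f → tt , here refl , labelling-ext zeros T (λ x → trans (entry-labelling (λ _ → 0) x) (sym (IsFilling.unfilled f x (nothingFilled x)))))
    (λ { tt _ _ → zeros-filling , filling∈candidates (λ { zero → z≤n ; (suc zero) → z≤n ; (suc (suc zero)) → z≤n }) zeros-filling , refl })
    where
    zeros : Label
    zeros = labelling (λ _ → 0)
    nothingFilled : ∀ x → ¬ Filled (heights 0 0 0) x
    nothingFilled (zero , j) ()
    nothingFilled (suc zero , j) ()
    nothingFilled (suc (suc zero) , j) ()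
    zeros-filling : IsFilling (heights 0 0 0) zeros
    zeros-filling = record
      { unfilled = λ x _ → entry-labelling (λ _ → 0) x
      ; range = λ x fx → ⊥-elim (nothingFilled x fx)
      ; injective = λ x y fx → ⊥-elim (nothingFilled x fx)
      ; surjective = λ ()
      ; rowInc = λ x y fx → ⊥-elim (nothingFilled x fx)
      ; colInc = λ x y fx → ⊥-elim (nothingFilled x fx) }

  LargestAt : Heights → Fin 3 → Label → Set
  LargestAt s i T = ∃ λ (j : Fin N) → suc (toℕ j) ≡ s i × entry T (i , j) ≡ size s

  largestAt? : ∀ s i T → Dec (LargestAt s i T)
  largestAt? s i T = any? (λ j → (suc (toℕ j) ≟ s i) ×-dec (entry T (i , j) ≟ size s))

  largest-unique : ∀ {s T i i′} → IsFilling s T → LargestAt s i T → LargestAt s i′ T → i ≡ i′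
  largest-unique f (j , last , e) (j′ , last′ , e′) =
    cong proj₁ (IsFilling.injective f _ _ (subst (toℕ j <_) last ≤-refl) (subst (toℕ j′ <_) last′ ≤-refl) (trans e (sym e′)))

  -- A non-empty filling has its largest entry at the end of some row: a filled
  -- cell following it in its row would carry a larger entry.
  largest-exists : ∀ {s T m} → Bounded s → IsFilling s T → size s ≡ suc m → ∃ λ i → LargestAt s i T
  largest-exists {s} {T} {m} bnd f size≡ = i , j , ≤-antisym filled (≮⇒≥ notLast) , trans eq (trans (cong suc (toℕ-fromℕ< m<size)) (sym size≡))
    where
    open IsFilling f
    m<size : m < size s
    m<size = subst (m <_) (sym size≡) ≤-refl
    largest : ∃ λ x → Filled s x × entry T x ≡ suc (toℕ (fromℕ< m<size))
    largest = surjective (fromℕ< m<size)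
    i : Fin 3
    i = proj₁ (proj₁ largest)
    j : Fin N
    j = proj₂ (proj₁ largest)
    filled : Filled s (i , j)
    filled = proj₁ (proj₂ largest)
    eq : entry T (i , j) ≡ suc (toℕ (fromℕ< m<size))
    eq = proj₂ (proj₂ largest)
    notLast : ¬ (suc (toℕ j) < s i)
    notLast next<s = <⇒≱ (rowInc (i , j) next filled next-filled refl col<)
                         (subst (entry T next ≤_) (sym (trans eq (trans (cong suc (toℕ-fromℕ< m<size)) (sym size≡)))) (proj₂ (range next next-filled)))
      where
      next<N : suc (toℕ j) < N
      next<N = ≤-trans next<s (bnd i)
      next : Cell
      next = (i , fromℕ< next<N)
      next-filled : Filled s next
      next-filled = subst (_< s i) (sym (toℕ-fromℕ< next<N)) next<s
      col< : col (i , j) < col next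
      col< = subst (toℕ i + toℕ j <_) (cong (toℕ i +_) (sym (toℕ-fromℕ< next<N))) (+-monoʳ-< (toℕ i) ≤-refl)

  size-grow : ∀ s s′ i → s i ≡ suc (s′ i) → (∀ i′ → i′ ≢ i → s i′ ≡ s′ i′) → size s ≡ suc (size s′)
  size-grow s s′ zero grow same
    rewrite grow | same (suc zero) (λ ()) | same (suc (suc zero)) (λ ()) = refl
  size-grow s s′ (suc zero) grow same
    rewrite grow | same zero (λ ()) | same (suc (suc zero)) (λ ()) = +-suc _ _
  size-grow s s′ (suc (suc zero)) grow same
    rewrite grow | same zero (λ ()) | same (suc zero) (λ ()) = trans (cong (s′ zero +_) (+-suc _ _)) (+-suc _ _)

  WithLargestAt : Heights → Fin 3 → Label → Set
  WithLargestAt s i T = IsFilling s T × LargestAt s i T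

  withLargestAt? : ∀ s i T → Dec (WithLargestAt s i T)
  withLargestAt? s i T = isFilling? s T ×-dec largestAt? s i T

  viaRow : Heights → Fin 3 → ℕ
  viaRow s i = length (filter (withLargestAt? s i) candidates)

  fillings-split : ∀ {s m} → Bounded s → size s ≡ suc m →
    fillings s ≡ viaRow s zero + viaRow s (suc zero) + viaRow s (suc (suc zero))
  fillings-split {s} bnd size≡ = begin
      fillings s
    ≡⟨ count-⊎ (isFilling? s) (withLargestAt? s zero) laterRows? candidates split₀ join₀ disjoint₀ ⟩
      viaRow s zero + length (filter laterRows? candidates)
    ≡⟨ cong (viaRow s zero +_) (count-⊎ laterRows? (withLargestAt? s (suc zero)) (withLargestAt? s (suc (suc zero))) candidates
          (λ { (f , inj₁ l) → inj₁ (f , l) ; (f , inj₂ l) → inj₂ (f , l) })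
          (λ { (inj₁ (f , l)) → f , inj₁ l ; (inj₂ (f , l)) → f , inj₂ l })
          (λ (f , l) (_ , l′) → 1≢2 (largest-unique f l l′))) ⟩
      viaRow s zero + (viaRow s (suc zero) + viaRow s (suc (suc zero)))
    ≡⟨ +-assoc (viaRow s zero) _ _ ⟨
      viaRow s zero + viaRow s (suc zero) + viaRow s (suc (suc zero)) ∎
    where
    open ≡-Reasoning
    LaterRows : Label → Set
    LaterRows T = IsFilling s T × (LargestAt s (suc zero) T ⊎ LargestAt s (suc (suc zero)) T)
    laterRows? : ∀ T → Dec (LaterRows T)
    laterRows? T = isFilling? s T ×-dec (largestAt? s (suc zero) T ⊎-dec largestAt? s (suc (suc zero)) T)
    split₀ : ∀ {T} → IsFilling s T → WithLargestAt s zero T ⊎ LaterRows T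
    split₀ f with largest-exists bnd f size≡
    ... | zero , l = inj₁ (f , l)
    ... | suc zero , l = inj₂ (f , inj₁ l)
    ... | suc (suc zero) , l = inj₂ (f , inj₂ l)
    join₀ : ∀ {T} → WithLargestAt s zero T ⊎ LaterRows T → IsFilling s T
    join₀ (inj₁ (f , _)) = f
    join₀ (inj₂ (f , _)) = f
    disjoint₀ : ∀ {T} → WithLargestAt s zero T → LaterRows T → ⊥
    disjoint₀ (f , l) (_ , inj₁ l′) with () ← largest-unique f l l′
    disjoint₀ (f , l) (_ , inj₂ l′) with () ← largest-unique f l l′
    1≢2 : suc zero ≢ suc (suc zero)
    1≢2 ()

  -- If nothing filled lies below the added cell, deleting the largest entry is a
  -- bijection from the fillings of s with largest entry in row i onto the
  -- fillings of s′; otherwise there are no such fillings of s.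
  module Removal (s s′ : Heights) (i : Fin 3) (grow : s i ≡ suc (s′ i))
                 (same : ∀ i′ → i′ ≢ i → s i′ ≡ s′ i′) (bnd : Bounded s) where

    s′i<N : s′ i < N
    s′i<N = subst (_≤ N) grow (bnd i)

    added : Cell
    added = (i , fromℕ< s′i<N)

    toℕ-added : toℕ (fromℕ< s′i<N) ≡ s′ i
    toℕ-added = toℕ-fromℕ< s′i<N

    size≡ : size s ≡ suc (size s′)
    size≡ = size-grow s s′ i grow same

    size′<size : ∀ {e} → e ≤ size s′ → e < size s
    size′<size e≤ = ≤-trans (s≤s e≤) (≤-reflexive (sym size≡))

    bnd′ : Bounded s′
    bnd′ i′ with i′ ≟ᶠ i
    ... | yes refl = <⇒≤ s′i<N
    ... | no i′≢i = subst (_≤ N) (same i′ i′≢i) (bnd i′)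

    added-filled : Filled s added
    added-filled = subst (_< s i) (sym toℕ-added) (subst (s′ i <_) (sym grow) ≤-refl)

    filled′⇒filled : ∀ x → Filled s′ x → Filled s x
    filled′⇒filled (i₁ , j) fx with i₁ ≟ᶠ i
    ... | yes refl = ≤-trans fx (≤-trans (n≤1+n _) (≤-reflexive (sym grow)))
    ... | no i₁≢i = subst (toℕ j <_) (sym (same i₁ i₁≢i)) fx

    filled′⇒≢added : ∀ x → Filled s′ x → x ≢ added
    filled′⇒≢added (i₁ , j) fx refl = <-irrefl toℕ-added fx

    filled⇒filled′ : ∀ x → Filled s x → x ≢ added → Filled s′ x
    filled⇒filled′ (i₁ , j) fx x≢added with i₁ ≟ᶠ i
    ... | yes refl = ≤∧≢⇒< (≤-pred (subst (suc (toℕ j) ≤_) grow fx))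
                           (λ e → x≢added (cong (i ,_) (toℕ-injective (trans e (sym toℕ-added)))))
    ... | no i₁≢i = subst (toℕ j <_) (same i₁ i₁≢i) fx

    largest⇒added : ∀ T → LargestAt s i T → entry T added ≡ size s
    largest⇒added T (j , last , e) =
      subst (λ j′ → entry T (i , j′) ≡ size s) (toℕ-injective (trans (suc-injective (trans last grow)) (sym toℕ-added))) e

    added⇒largest : ∀ T → entry T added ≡ size s → LargestAt s i T
    added⇒largest T e = fromℕ< s′i<N , trans (cong suc toℕ-added) (sym grow) , e

    Corner : Set
    Corner = ∀ x → Filled s x → col x ≡ col added → toℕ i < row x → ⊥

    Blocked : Set
    Blocked = ∃ λ x → Filled s x × col x ≡ col added × toℕ i < row x

    remove restore : Label → Label
    remove T = T [ added ]≔ 0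
    restore T = T [ added ]≔ size s

    removal-filling : ∀ {T} → WithLargestAt s i T → IsFilling s′ (remove T)
    removal-filling {T} (f , l) = record
      { unfilled = unfilled′
      ; range = λ x fx → let x≢ = filled′⇒≢added x fx ; (1≤e , e≤) = range x (filled′⇒filled x fx) in
                subst (λ e → 1 ≤ e × e ≤ size s′) (sym (kept x x≢))
                  (1≤e , ≤-pred (≤∧≢⇒< (subst (entry T x ≤_) size≡ e≤)
                                      (λ e → x≢ (injective x added (filled′⇒filled x fx) added-filled (trans e (trans (sym size≡) (sym top)))))))
      ; injective = λ x y fx fy e → injective x y (filled′⇒filled x fx) (filled′⇒filled y fy)
                      (trans (sym (kept x (filled′⇒≢added x fx))) (trans e (kept y (filled′⇒≢added y fy))))
      ; surjective = surjective′
      ; rowInc = λ x y fx fy r c → subst₂ _<_ (sym (kept x (filled′⇒≢added x fx))) (sym (kept y (filled′⇒≢added y fy)))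
                                     (rowInc x y (filled′⇒filled x fx) (filled′⇒filled y fy) r c)
      ; colInc = λ x y fx fy c r → subst₂ _<_ (sym (kept x (filled′⇒≢added x fx))) (sym (kept y (filled′⇒≢added y fy)))
                                     (colInc x y (filled′⇒filled x fx) (filled′⇒filled y fy) c r) }
      where
      open IsFilling f
      top : entry T added ≡ size s
      top = largest⇒added T l
      kept : ∀ x → x ≢ added → entry (remove T) x ≡ entry T x
      kept x = entry-≔-elsewhere T added 0 x
      unfilled′ : ∀ x → ¬ Filled s′ x → entry (remove T) x ≡ 0
      unfilled′ x ¬fx with x ≟ᶜ added
      ... | yes refl = entry-≔-here T added 0
      ... | no x≢ = trans (kept x x≢) (unfilled x (λ fx → ¬fx (filled⇒filled′ x fx x≢)))
      surjective′ : ∀ (k : Fin (size s′)) → ∃ λ x → Filled s′ x × entry (remove T) x ≡ suc (toℕ k)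
      surjective′ k = x , filled⇒filled′ x fx x≢ , trans (kept x x≢) (trans e (cong suc (toℕ-fromℕ< k<)))
        where
        k< : toℕ k < size s
        k< = ≤-trans (toℕ<n k) (<⇒≤ (size′<size ≤-refl))
        found : ∃ λ x → Filled s x × entry T x ≡ suc (toℕ (fromℕ< k<))
        found = surjective (fromℕ< k<)
        x : Cell
        x = proj₁ found
        fx : Filled s x
        fx = proj₁ (proj₂ found)
        e : entry T x ≡ suc (toℕ (fromℕ< k<))
        e = proj₂ (proj₂ found)
        x≢ : x ≢ added
        x≢ x≡ = <-irrefl (suc-injective (trans (sym (trans e (cong suc (toℕ-fromℕ< k<)))) (trans (cong (entry T) x≡) (trans top size≡)))) (toℕ<n k)

    restoration-filling : Corner → ∀ {T} → IsFilling s′ T → WithLargestAt s i (restore T)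
    restoration-filling corner {T} f = record
      { unfilled = λ x ¬fx → trans (kept x (λ x≡ → ¬fx (subst (Filled s) (sym x≡) added-filled)))
                                   (unfilled x (λ fx′ → ¬fx (filled′⇒filled x fx′)))
      ; range = range′
      ; injective = injective′
      ; surjective = surjective′
      ; rowInc = rowInc′
      ; colInc = colInc′ } , added⇒largest (restore T) new
      where
      open IsFilling f
      kept : ∀ x → x ≢ added → entry (restore T) x ≡ entry T x
      kept x = entry-≔-elsewhere T added (size s) x
      new : entry (restore T) added ≡ size s
      new = entry-≔-here T added (size s)
      below : ∀ x → Filled s′ x → entry (restore T) x < size s
      below x fx = subst (_< size s) (sym (kept x (filled′⇒≢added x fx))) (size′<size (proj₂ (range x fx)))
      range′ : ∀ x → Filled s x → 1 ≤ entry (restore T) x × entry (restore T) x ≤ size s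
      range′ x fx with x ≟ᶜ added
      ... | yes refl = subst (λ e → 1 ≤ e × e ≤ size s) (sym new) (subst (1 ≤_) (sym size≡) (s≤s z≤n) , ≤-refl)
      ... | no x≢ = let (1≤e , e≤) = range x (filled⇒filled′ x fx x≢) in
                    subst (λ e → 1 ≤ e × e ≤ size s) (sym (kept x x≢)) (1≤e , <⇒≤ (size′<size e≤))
      injective′ : ∀ x y → Filled s x → Filled s y → entry (restore T) x ≡ entry (restore T) y → x ≡ y
      injective′ x y fx fy e with x ≟ᶜ added | y ≟ᶜ added
      ... | yes x≡ | yes y≡ = trans x≡ (sym y≡)
      ... | yes refl | no y≢ = ⊥-elim (<-irrefl (sym (trans (sym new) e)) (below y (filled⇒filled′ y fy y≢)))
      ... | no x≢ | yes refl = ⊥-elim (<-irrefl (trans e new) (below x (filled⇒filled′ x fx x≢)))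
      ... | no x≢ | no y≢ = injective x y (filled⇒filled′ x fx x≢) (filled⇒filled′ y fy y≢) (trans (sym (kept x x≢)) (trans e (kept y y≢)))
      surjective′ : ∀ (k : Fin (size s)) → ∃ λ x → Filled s x × entry (restore T) x ≡ suc (toℕ k)
      surjective′ k with toℕ k ≟ size s′
      ... | yes k≡ = added , added-filled , trans new (trans size≡ (cong suc (sym k≡)))
      ... | no k≢ = x , filled′⇒filled x fx , trans (kept x (filled′⇒≢added x fx)) (trans e (cong suc (toℕ-fromℕ< k<)))
        where
        k< : toℕ k < size s′
        k< = ≤∧≢⇒< (≤-pred (subst (toℕ k <_) size≡ (toℕ<n k))) k≢
        found : ∃ λ x → Filled s′ x × entry T x ≡ suc (toℕ (fromℕ< k<))
        found = surjective (fromℕ< k<)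
        x : Cell
        x = proj₁ found
        fx : Filled s′ x
        fx = proj₁ (proj₂ found)
        e : entry T x ≡ suc (toℕ (fromℕ< k<))
        e = proj₂ (proj₂ found)
      lastInRow : ∀ y → Filled s y → row added ≡ row y → col added < col y → ⊥
      lastInRow (i′ , j′) fy r c with toℕ-injective r
      ... | refl = <⇒≱ (+-cancelˡ-< (toℕ i) _ _ c) (≤-trans (≤-pred (subst (suc (toℕ j′) ≤_) grow fy)) (≤-reflexive (sym toℕ-added)))
      rowInc′ : ∀ x y → Filled s x → Filled s y → row x ≡ row y → col x < col y → entry (restore T) x < entry (restore T) y
      rowInc′ x y fx fy r c with x ≟ᶜ added | y ≟ᶜ added
      ... | yes refl | yes refl = ⊥-elim (<-irrefl refl c)
      ... | yes refl | no _ = ⊥-elim (lastInRow y fy r c)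
      ... | no x≢ | yes refl = subst (entry (restore T) x <_) (sym new) (below x (filled⇒filled′ x fx x≢))
      ... | no x≢ | no y≢ = subst₂ _<_ (sym (kept x x≢)) (sym (kept y y≢))
                              (rowInc x y (filled⇒filled′ x fx x≢) (filled⇒filled′ y fy y≢) r c)
      colInc′ : ∀ x y → Filled s x → Filled s y → col x ≡ col y → row x < row y → entry (restore T) x < entry (restore T) y
      colInc′ x y fx fy c r with x ≟ᶜ added | y ≟ᶜ added
      ... | yes refl | yes refl = ⊥-elim (<-irrefl refl r)
      ... | yes refl | no _ = ⊥-elim (corner y fy (sym c) r)
      ... | no x≢ | yes refl = subst (entry (restore T) x <_) (sym new) (below x (filled⇒filled′ x fx x≢))
      ... | no x≢ | no y≢ = subst₂ _<_ (sym (kept x x≢)) (sym (kept y y≢))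
                              (colInc x y (filled⇒filled′ x fx x≢) (filled⇒filled′ y fy y≢) c r)

    viaRow-corner : Corner → viaRow s i ≡ fillings s′
    viaRow-corner corner = count-bijection (withLargestAt? s i) (isFilling? s′) candidates candidates remove restore
      candidates-unique candidates-unique
      (λ T _ wl → let f′ = removal-filling wl in f′ , filling∈candidates bnd′ f′ , restore∘remove T wl)
      (λ T _ f → let wl = restoration-filling corner f in wl , filling∈candidates bnd (proj₁ wl) , remove∘restore T f)
      where
      restore∘remove : ∀ T → WithLargestAt s i T → restore (remove T) ≡ T
      restore∘remove T (_ , l) = labelling-ext _ T λ x → case x
        where
        case : ∀ x → entry (restore (remove T)) x ≡ entry T x
        case x with x ≟ᶜ added
        ... | yes refl = trans (entry-≔-here (remove T) added (size s)) (sym (largest⇒added T l))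
        ... | no x≢ = trans (entry-≔-elsewhere (remove T) added _ x x≢) (entry-≔-elsewhere T added 0 x x≢)
      remove∘restore : ∀ T → IsFilling s′ T → remove (restore T) ≡ T
      remove∘restore T f = labelling-ext _ T λ x → case x
        where
        case : ∀ x → entry (remove (restore T)) x ≡ entry T x
        case x with x ≟ᶜ added
        ... | yes refl = trans (entry-≔-here (restore T) added 0)
                               (sym (IsFilling.unfilled f added (λ fx′ → filled′⇒≢added added fx′ refl)))
        ... | no x≢ = trans (entry-≔-elsewhere (restore T) added _ x x≢) (entry-≔-elsewhere T added (size s) x x≢)

    -- a filled cell below the added one would have to exceed the largest entry
    viaRow-blocked : Blocked → viaRow s i ≡ 0
    viaRow-blocked (y , fy , c , r) = count-none (withLargestAt? s i) candidates λ T (f , l) →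
      <⇒≱ (IsFilling.colInc f added y added-filled fy (sym c) r)
          (subst (entry T y ≤_) (sym (largest⇒added T l)) (proj₂ (IsFilling.range f y fy)))

  bounded : ∀ {a b c} → a ≤ N → b ≤ N → c ≤ N → Bounded (heights a b c)
  bounded ha hb hc zero = ha
  bounded ha hb hc (suc zero) = hb
  bounded ha hb hc (suc (suc zero)) = hc

  others₀ : ∀ a b c i′ → i′ ≢ zero → heights (suc a) b c i′ ≡ heights a b c i′
  others₀ a b c zero i′≢ = ⊥-elim (i′≢ refl)
  others₀ a b c (suc zero) _ = refl
  others₀ a b c (suc (suc zero)) _ = refl

  others₁ : ∀ a b c i′ → i′ ≢ suc zero → heights a (suc b) c i′ ≡ heights a b c i′
  others₁ a b c zero _ = refl
  others₁ a b c (suc zero) i′≢ = ⊥-elim (i′≢ refl)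
  others₁ a b c (suc (suc zero)) _ = refl

  others₂ : ∀ a b c i′ → i′ ≢ suc (suc zero) → heights a b (suc c) i′ ≡ heights a b c i′
  others₂ a b c zero _ = refl
  others₂ a b c (suc zero) _ = refl
  others₂ a b c (suc (suc zero)) i′≢ = ⊥-elim (i′≢ refl)

  viaRow-emptyRow : ∀ s i → s i ≡ 0 → viaRow s i ≡ 0
  viaRow-emptyRow s i empty = count-none (withLargestAt? s i) candidates (λ T (_ , (j , last , _)) → 1+n≢0 (trans last empty))

  -- The arithmetic corner conditions of cnt describe the geometric ones.
  viaRow₀-correct : ∀ a b c → suc a ≤ N → b ≤ N → c ≤ N → fillings (heights a b c) ≡ cnt a b c →
    viaRow (heights (suc a) b c) zero ≡ viaRow₀ (suc a) b c
  viaRow₀-correct a b c ha hb hc ih = by (corner₀? a b c)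
    where
    module R = Removal (heights (suc a) b c) (heights a b c) zero refl (others₀ a b c) (bounded ha hb hc)
    geometric : Corner₀ a b c → R.Corner
    geometric (inj₁ a≡0 , _) (suc zero , j) fx c≡ _ = 1+n≢0 (trans c≡ (trans R.toℕ-added a≡0))
    geometric (inj₂ b<a , _) (suc zero , j) fx c≡ _ = <⇒≱ fx (≤-pred (≤-trans b<a (≤-reflexive (sym (trans c≡ R.toℕ-added)))))
    geometric (_ , inj₁ a≤1) (suc (suc zero) , j) fx c≡ _ = <⇒≱ (s≤s (s≤s z≤n)) (≤-trans (≤-reflexive (trans c≡ R.toℕ-added)) a≤1)
    geometric (_ , inj₂ 1+c<a) (suc (suc zero) , j) fx c≡ _ = <⇒≱ fx (≤-pred (≤-pred (≤-trans 1+c<a (≤-reflexive (sym (trans c≡ R.toℕ-added))))))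
    blocking : (0 < a × a ≤ b) ⊎ (1 < a × a ≤ suc c) → R.Blocked
    blocking (inj₁ (s≤s {n = a′} z≤n , a≤b)) =
      (suc zero , fromℕ< a′<N) , subst (_< b) (sym (toℕ-fromℕ< a′<N)) a≤b
      , trans (cong suc (toℕ-fromℕ< a′<N)) (sym R.toℕ-added) , s≤s z≤n
      where
      a′<N : a′ < N
      a′<N = ≤-trans a≤b hb
    blocking (inj₂ (s≤s (s≤s {n = a′} z≤n) , a≤1+c)) =
      (suc (suc zero) , fromℕ< a′<N) , subst (_< c) (sym (toℕ-fromℕ< a′<N)) (≤-pred a≤1+c)
      , trans (cong (λ n → suc (suc n)) (toℕ-fromℕ< a′<N)) (sym R.toℕ-added) , s≤s z≤n
      where
      a′<N : a′ < N
      a′<N = ≤-trans (≤-pred a≤1+c) hc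
    by : Dec (Corner₀ a b c) → viaRow (heights (suc a) b c) zero ≡ viaRow₀ (suc a) b c
    by (yes corner) = trans (R.viaRow-corner (geometric corner)) (trans ih (sym (viaRow₀-corner a b c corner)))
    by (no ¬corner) = trans (R.viaRow-blocked (blocking below)) (sym (viaRow₀-blocked a b c below))
      where
      below : (0 < a × a ≤ b) ⊎ (1 < a × a ≤ suc c)
      below = ¬corner₀⇒blocked a b c ¬corner

  viaRow₁-correct : ∀ a b c → a ≤ N → suc b ≤ N → c ≤ N → fillings (heights a b c) ≡ cnt a b c →
    viaRow (heights a (suc b) c) (suc zero) ≡ viaRow₁ a (suc b) c
  viaRow₁-correct a b c ha hb hc ih = by (corner₁? b c)
    where
    module R = Removal (heights a (suc b) c) (heights a b c) (suc zero) refl (others₁ a b c) (bounded ha hb hc)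
    geometric : Corner₁ b c → R.Corner
    geometric corner (suc zero , j) fx c≡ (s≤s ())
    geometric (inj₁ b≡0) (suc (suc zero) , j) fx c≡ _ = 1+n≢0 (trans (suc-injective c≡) (trans R.toℕ-added b≡0))
    geometric (inj₂ c<b) (suc (suc zero) , j) fx c≡ _ =
      <⇒≱ fx (≤-pred (≤-trans c<b (≤-reflexive (sym (trans (suc-injective c≡) R.toℕ-added)))))
    blocking : 0 < b × b ≤ c → R.Blocked
    blocking (s≤s {n = b′} z≤n , b≤c) =
      (suc (suc zero) , fromℕ< b′<N) , subst (_< c) (sym (toℕ-fromℕ< b′<N)) b≤c
      , cong suc (trans (cong suc (toℕ-fromℕ< b′<N)) (sym R.toℕ-added)) , s≤s (s≤s z≤n)
      where
      b′<N : b′ < N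
      b′<N = ≤-trans b≤c hc
    by : Dec (Corner₁ b c) → viaRow (heights a (suc b) c) (suc zero) ≡ viaRow₁ a (suc b) c
    by (yes corner) = trans (R.viaRow-corner (geometric corner)) (trans ih (sym (viaRow₁-corner a b c corner)))
    by (no ¬corner) = let (0<b , b≤c) = ¬corner₁⇒blocked b c ¬corner in
      trans (R.viaRow-blocked (blocking (0<b , b≤c))) (sym (viaRow₁-blocked a b c 0<b b≤c))

  -- nothing lies below the last cell of the bottom row
  viaRow₂-correct : ∀ a b c → a ≤ N → b ≤ N → suc c ≤ N → fillings (heights a b c) ≡ cnt a b c →
    viaRow (heights a b (suc c)) (suc (suc zero)) ≡ viaRow₂ a b (suc c)
  viaRow₂-correct a b c ha hb hc ih = trans (R.viaRow-corner bottom) ih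
    where
    module R = Removal (heights a b (suc c)) (heights a b c) (suc (suc zero)) refl (others₂ a b c) (bounded ha hb hc)
    bottom : R.Corner
    bottom (suc (suc zero) , j) fx c≡ (s≤s (s≤s ()))

  assemble : ∀ a b c {m} → Bounded (heights a b c) → size (heights a b c) ≡ suc m →
    viaRow (heights a b c) zero ≡ viaRow₀ a b c →
    viaRow (heights a b c) (suc zero) ≡ viaRow₁ a b c →
    viaRow (heights a b c) (suc (suc zero)) ≡ viaRow₂ a b c →
    fillings (heights a b c) ≡ viaRow₀ a b c + viaRow₁ a b c + viaRow₂ a b c
  assemble a b c bnd size≡ row₀ row₁ row₂ = trans (fillings-split bnd size≡) (cong₂ _+_ (cong₂ _+_ row₀ row₁) row₂)

  fillings≡cnt : ∀ a b c → a ≤ N → b ≤ N → c ≤ N → fillings (heights a b c) ≡ cnt a b c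
  fillings≡cnt zero zero zero _ _ _ = fillings-empty
  fillings≡cnt zero zero (suc c) ha hb hc = assemble zero zero (suc c) (bounded ha hb hc) refl
    (viaRow-emptyRow _ zero refl)
    (viaRow-emptyRow _ (suc zero) refl)
    (viaRow₂-correct zero zero c ha hb hc (fillings≡cnt zero zero c ha hb (≤-trans (n≤1+n _) hc)))
  fillings≡cnt zero (suc b) zero ha hb hc = assemble zero (suc b) zero (bounded ha hb hc) refl
    (viaRow-emptyRow _ zero refl)
    (viaRow₁-correct zero b zero ha hb hc (fillings≡cnt zero b zero ha (≤-trans (n≤1+n _) hb) hc))
    (viaRow-emptyRow _ (suc (suc zero)) refl)
  fillings≡cnt zero (suc b) (suc c) ha hb hc = assemble zero (suc b) (suc c) (bounded ha hb hc) refl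
    (viaRow-emptyRow _ zero refl)
    (viaRow₁-correct zero b (suc c) ha hb hc (fillings≡cnt zero b (suc c) ha (≤-trans (n≤1+n _) hb) hc))
    (viaRow₂-correct zero (suc b) c ha hb hc (fillings≡cnt zero (suc b) c ha hb (≤-trans (n≤1+n _) hc)))
  fillings≡cnt (suc a) zero zero ha hb hc = assemble (suc a) zero zero (bounded ha hb hc) refl
    (viaRow₀-correct a zero zero ha hb hc (fillings≡cnt a zero zero (≤-trans (n≤1+n _) ha) hb hc))
    (viaRow-emptyRow _ (suc zero) refl)
    (viaRow-emptyRow _ (suc (suc zero)) refl)
  fillings≡cnt (suc a) zero (suc c) ha hb hc = assemble (suc a) zero (suc c) (bounded ha hb hc) refl
    (viaRow₀-correct a zero (suc c) ha hb hc (fillings≡cnt a zero (suc c) (≤-trans (n≤1+n _) ha) hb hc))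
    (viaRow-emptyRow _ (suc zero) refl)
    (viaRow₂-correct (suc a) zero c ha hb hc (fillings≡cnt (suc a) zero c ha hb (≤-trans (n≤1+n _) hc)))
  fillings≡cnt (suc a) (suc b) zero ha hb hc = assemble (suc a) (suc b) zero (bounded ha hb hc) refl
    (viaRow₀-correct a (suc b) zero ha hb hc (fillings≡cnt a (suc b) zero (≤-trans (n≤1+n _) ha) hb hc))
    (viaRow₁-correct (suc a) b zero ha hb hc (fillings≡cnt (suc a) b zero ha (≤-trans (n≤1+n _) hb) hc))
    (viaRow-emptyRow _ (suc (suc zero)) refl)
  fillings≡cnt (suc a) (suc b) (suc c) ha hb hc = assemble (suc a) (suc b) (suc c) (bounded ha hb hc) refl
    (viaRow₀-correct a (suc b) (suc c) ha hb hc (fillings≡cnt a (suc b) (suc c) (≤-trans (n≤1+n _) ha) hb hc))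
    (viaRow₁-correct (suc a) b (suc c) ha hb hc (fillings≡cnt (suc a) b (suc c) ha (≤-trans (n≤1+n _) hb) hc))
    (viaRow₂-correct (suc a) (suc b) c ha hb hc (fillings≡cnt (suc a) (suc b) c ha hb (≤-trans (n≤1+n _) hc)))

g₃≡cnt : ∀ N → g 3 N ≡ cnt N N N
g₃≡cnt N = trans g≡fillings-full (fillings≡cnt N N N ≤-refl ≤-refl ≤-refl)
  where open ThreeRows N

-- Hook-length formula for shifted strict shapes.  For two rows a > b it reads
--   cnt a b 0 · a! b! (a + b) = (a + b)! (a − b),
-- stated below with d = a − b given separately.
TwoRowHook : ℕ → ℕ → ℕ → Set
TwoRowHook a b d = cnt a b 0 * (a ! * b ! * (a + b)) ≡ (a + b) ! * d

+-suc² : ∀ b p → b + suc (suc p) ≡ suc (suc (b + p))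
+-suc² b p = trans (+-suc b (suc p)) (cong suc (+-suc b p))

-- The contribution of row 0 to the shape (a, b + 1) with a = b + p + 2, weighted
-- as in the formula for the shape (a − 1, b + 1): zero if p = 0 (the rows then
-- have equal length after removal), and the formula for that shape otherwise.
twoRow-row₀-blocked : ∀ b → viaRow₀ (suc (b + 1)) (suc b) 0 * ((b + 1) ! * (suc b * b !) * ((b + 1) + suc b))
                              ≡ ((b + 1) + suc b) ! * 0
twoRow-row₀-blocked b
  rewrite viaRow₀-blocked (b + 1) (suc b) 0 (inj₁ (≤-trans (s≤s z≤n) (≤-reflexive (sym (+-suc b 0)))
                                                  , ≤-reflexive (trans (+-suc b 0) (cong suc (+-identityʳ b)))))
  = sym (*-zeroʳ (((b + 1) + suc b) !))

twoRow-row₀-corner : ∀ b p → TwoRowHook (suc b + suc p) (suc b) (suc p) →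
  viaRow₀ (suc (b + suc (suc p))) (suc b) 0 * ((b + suc (suc p)) ! * (suc b * b !) * ((b + suc (suc p)) + suc b))
    ≡ ((b + suc (suc p)) + suc b) ! * suc p
twoRow-row₀-corner b p ih
  rewrite viaRow₀-corner (b + suc (suc p)) (suc b) 0
            ( inj₂ (≤-trans (s≤s (s≤s (m≤m+n b p))) (≤-reflexive (sym (+-suc² b p))))
            , inj₂ (≤-trans (s≤s (s≤s z≤n)) (≤-reflexive (sym (+-suc² b p)))))
  = subst (λ a → cnt a (suc b) 0 * (a ! * (suc b * b !) * (a + suc b)) ≡ (a + suc b) ! * suc p) (sym (+-suc b (suc p))) ih

-- One step of the recursion: the formula for (a − 1, b + 1) and (a, b) [through the
-- contribution of row 0 and the induction hypothesis] gives it for (a, b + 1).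
twoRow-step : ∀ b p → TwoRowHook (b + suc (suc p)) b (suc (suc p)) →
  (viaRow₀ (suc (b + suc p)) (suc b) 0 * ((b + suc p) ! * (suc b * b !) * ((b + suc p) + suc b)) ≡ ((b + suc p) + suc b) ! * p) →
  TwoRowHook (suc b + suc p) (suc b) (suc p)
twoRow-step b p shorter row₀ = goal
  where
  a1 N1 N2 X Y F : ℕ
  a1 = b + suc p
  N1 = viaRow₀ (suc a1) (suc b) 0
  N2 = cnt (suc a1) b 0
  X = a1 !
  Y = b !
  F = (a1 + suc b) !
  -- with only two rows, the last box of row 1 is always a corner
  unfold : cnt (suc a1) (suc b) 0 ≡ N1 + N2
  unfold = trans (+-identityʳ _) (cong (N1 +_) (viaRow₁-corner (suc a1) b 0 (corner b)))
    where corner : ∀ b → Corner₁ b 0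
          corner zero = inj₁ refl
          corner (suc b) = inj₂ z<s
  row₁ : N2 * ((suc a1 * X) * Y * (suc a1 + b)) ≡ F * suc (suc p)
  row₁ = trans shorter′ (cong (λ z → z ! * suc (suc p)) (sym (+-suc (b + suc p) b)))
    where shorter′ = subst (λ a → cnt a b 0 * (a ! * b ! * (a + b)) ≡ (a + b) ! * suc (suc p)) (+-suc b (suc p)) shorter
  cleared : (N1 + N2) * ((suc a1 * X) * (suc b * Y) * (suc a1 + suc b)) ≡ (suc (a1 + suc b) * F) * suc p
  cleared = *-cancelʳ-≡ _ _ (suc (b + p + suc b)) (begin
      (N1 + N2) * ((suc a1 * X) * (suc b * Y) * (suc a1 + suc b)) * suc (b + p + suc b)
        ≡⟨ regroup b p N1 N2 X Y ⟩
      suc a1 * (suc a1 + suc b) * (N1 * (X * (suc b * Y) * (a1 + suc b))) + suc b * (suc a1 + suc b) * (N2 * ((suc a1 * X) * Y * (suc a1 + b)))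
        ≡⟨ cong₂ (λ u v → suc a1 * (suc a1 + suc b) * u + suc b * (suc a1 + suc b) * v) row₀ row₁ ⟩
      suc a1 * (suc a1 + suc b) * (F * p) + suc b * (suc a1 + suc b) * (F * suc (suc p))
        ≡⟨ collect b p F ⟩
      (suc (a1 + suc b) * F) * suc p * suc (b + p + suc b) ∎)
    where
    open ≡-Reasoning
    regroup : ∀ b p N1 N2 X Y → (N1 + N2) * ((suc (b + suc p) * X) * (suc b * Y) * (suc (b + suc p) + suc b)) * suc (b + p + suc b)
         ≡ suc (b + suc p) * (suc (b + suc p) + suc b) * (N1 * (X * (suc b * Y) * ((b + suc p) + suc b))) + suc b * (suc (b + suc p) + suc b) * (N2 * ((suc (b + suc p) * X) * Y * (suc (b + suc p) + b)))
    regroup = solve-∀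
    collect : ∀ b p F → suc (b + suc p) * (suc (b + suc p) + suc b) * (F * p) + suc b * (suc (b + suc p) + suc b) * (F * suc (suc p))
         ≡ (suc ((b + suc p) + suc b) * F) * suc p * suc (b + p + suc b)
    collect = solve-∀
  goal : cnt (suc b + suc p) (suc b) 0 * ((suc b + suc p) ! * suc b ! * (suc b + suc p + suc b)) ≡ (suc b + suc p + suc b) ! * suc p
  goal rewrite unfold = cleared

twoRowHook : ∀ b p → TwoRowHook (b + suc p) b (suc p)
twoRowHook zero p rewrite +-identityʳ p = trans (cong (_* (suc p ! * 1 * suc p)) (cnt-oneRow (suc p))) (units (suc p !) (suc p))
  where units : ∀ x y → 1 * (x * 1 * y) ≡ x * y
        units = solve-∀
twoRowHook (suc b) zero = twoRow-step b 0 (twoRowHook b 1) (twoRow-row₀-blocked b)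
twoRowHook (suc b) (suc p) = twoRow-step b (suc p) (twoRowHook b (suc (suc p))) (twoRow-row₀-corner b p (twoRowHook (suc b) p))

-- For three rows a > b > c the formula reads
--   cnt a b c · a! b! c! (a+b)(a+c)(b+c) = (a+b+c)! (a−b)(a−c)(b−c);
-- below a − b = p + 1 and b − c = q + 1.
diffs : ℕ → ℕ → ℕ
diffs p q = suc p * (suc p + suc q) * suc q

sums : ℕ → ℕ → ℕ → ℕ
sums a b c = (a + b) * (a + c) * (b + c)

ThreeRowHook : ℕ → ℕ → ℕ → ℕ → ℕ → Set
ThreeRowHook a b c p q = cnt a b c * (a ! * b ! * c ! * sums a b c) ≡ (a + b + c) ! * diffs p q

-- One step: the contributions of the three rows, each weighted as in the formula
-- for the shape with that box removed, add up to the formula.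
threeRow-step : ∀ p q c1 →
  let c = suc c1 ; b1 = c + q ; b = suc b1 ; a1 = b + p ; a = suc a1 in
  viaRow₀ a b c * (a1 ! * b ! * c ! * sums a1 b c) ≡ (a1 + b + c) ! * (p * (p + suc q) * suc q) →
  viaRow₁ a b c * (a ! * b1 ! * c ! * sums a b1 c) ≡ (a + b1 + c) ! * (suc (suc p) * (suc (suc p) + q) * q) →
  cnt a b c1 * (a ! * b ! * c1 ! * sums a b c1) ≡ (a + b + c1) ! * diffs p (suc q) →
  ThreeRowHook a b c p q
threeRow-step p q c1 row₀ row₁ row₂ = cleared
  where
  c b1 b a1 a X Y Z F N0 N1 N2 M : ℕ
  c = suc c1
  b1 = c + q
  b = suc b1
  a1 = b + p
  a = suc a1
  X = a1 !
  Y = b1 !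
  Z = c1 !
  F = (a1 + b + c) !
  N0 = viaRow₀ a b c
  N1 = viaRow₁ a b c
  N2 = cnt a b c1
  row₁′ : N1 * ((a * X) * Y * (c * Z) * sums a b1 c) ≡ F * (suc (suc p) * (suc (suc p) + q) * q)
  row₁′ = trans row₁ (cong (λ z → z ! * (suc (suc p) * (suc (suc p) + q) * q)) (cong (_+ c) (sym (+-suc a1 b1))))
  row₂′ : N2 * ((a * X) * (b * Y) * Z * sums a b c1) ≡ F * diffs p (suc q)
  row₂′ = trans row₂ (cong (λ z → z ! * diffs p (suc q)) (sym (+-suc (a1 + b) c1)))
  M = sums a1 b c * sums a b1 c * sums a b c1
  regroup : ∀ N0 N1 N2 X Y Z a b c P P0 P1 P2 →
    (N0 + N1 + N2) * ((a * X) * (b * Y) * (c * Z) * P) * (P0 * P1 * P2)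
    ≡ a * P * (P1 * P2) * (N0 * (X * (b * Y) * (c * Z) * P0))
      + b * P * (P0 * P2) * (N1 * ((a * X) * Y * (c * Z) * P1))
      + c * P * (P0 * P1) * (N2 * ((a * X) * (b * Y) * Z * P2))
  regroup = solve-∀
  collect : ∀ p q c1 F →
    let c = suc c1 ; b1 = c + q ; b = suc b1 ; a1 = b + p ; a = suc a1 ; s1 = a1 + b + c in
    a * ((a + b) * (a + c) * (b + c)) * (((a + b1) * (a + c) * (b1 + c)) * ((a + b) * (a + c1) * (b + c1))) * (F * (p * (p + suc q) * suc q))
      + b * ((a + b) * (a + c) * (b + c)) * (((a1 + b) * (a1 + c) * (b + c)) * ((a + b) * (a + c1) * (b + c1))) * (F * (suc (suc p) * (suc (suc p) + q) * q))
      + c * ((a + b) * (a + c) * (b + c)) * (((a1 + b) * (a1 + c) * (b + c)) * ((a + b1) * (a + c) * (b1 + c))) * (F * (suc p * (suc p + suc (suc q)) * suc (suc q)))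
    ≡ (suc s1 * F) * (suc p * (suc p + suc q) * suc q) * (((a1 + b) * (a1 + c) * (b + c)) * ((a + b1) * (a + c) * (b1 + c)) * ((a + b) * (a + c1) * (b + c1)))
  collect = solve-∀
  open ≡-Reasoning
  cleared : ThreeRowHook a b c p q
  cleared = *-cancelʳ-≡ _ _ M (begin
      (N0 + N1 + N2) * ((a * X) * (b * Y) * (c * Z) * sums a b c) * M
        ≡⟨ regroup N0 N1 N2 X Y Z a b c (sums a b c) (sums a1 b c) (sums a b1 c) (sums a b c1) ⟩
      a * sums a b c * (sums a b1 c * sums a b c1) * (N0 * (X * (b * Y) * (c * Z) * sums a1 b c))
      + b * sums a b c * (sums a1 b c * sums a b c1) * (N1 * ((a * X) * Y * (c * Z) * sums a b1 c))
      + c * sums a b c * (sums a1 b c * sums a b1 c) * (N2 * ((a * X) * (b * Y) * Z * sums a b c1))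
        ≡⟨ cong₂ _+_ (cong₂ _+_ (cong (a * sums a b c * (sums a b1 c * sums a b c1) *_) row₀) (cong (b * sums a b c * (sums a1 b c * sums a b c1) *_) row₁′)) (cong (c * sums a b c * (sums a1 b c * sums a b1 c) *_) row₂′) ⟩
      a * sums a b c * (sums a b1 c * sums a b c1) * (F * (p * (p + suc q) * suc q))
      + b * sums a b c * (sums a1 b c * sums a b c1) * (F * (suc (suc p) * (suc (suc p) + q) * q))
      + c * sums a b c * (sums a1 b c * sums a b1 c) * (F * diffs p (suc q))
        ≡⟨ collect p q c1 F ⟩
      (suc (a1 + b + c) * F) * diffs p q * M ∎)

-- c = 0 is the two-row formula
threeRow-base : ∀ p q → ThreeRowHook (suc (suc q + p)) (suc q) 0 p q
threeRow-base p q = trans (reshape p q N A B) (trans (cong (_* (a * suc q)) twoRows) (trans (diffs-form p q F) (cong (λ z → z ! * diffs p q) (sym (+-identityʳ (a + suc q))))))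
  where
  a N A B F : ℕ
  a = suc (suc q + p)
  N = cnt a (suc q) 0
  A = a !
  B = (suc q) !
  F = (a + suc q) !
  twoRows : N * (A * B * (a + suc q)) ≡ F * suc p
  twoRows = subst (λ x → TwoRowHook x (suc q) (suc p)) (+-suc (suc q) p) (twoRowHook (suc q) p)
  reshape : ∀ p q N A B → N * (A * B * 1 * ((suc (suc q + p) + suc q) * (suc (suc q + p) + 0) * (suc q + 0)))
       ≡ N * (A * B * (suc (suc q + p) + suc q)) * (suc (suc q + p) * suc q)
  reshape = solve-∀
  diffs-form : ∀ p q F → F * suc p * (suc (suc q + p) * suc q) ≡ F * (suc p * (suc p + suc q) * suc q)
  diffs-form = solve-∀

threeRow-row₂ : ∀ c q p → ThreeRowHook (suc (suc (c + suc q) + p)) (suc (c + suc q)) c p (suc q) →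
                          ThreeRowHook (suc (suc (suc (c + q)) + p)) (suc (suc (c + q))) c p (suc q)
threeRow-row₂ c q p ih = subst (λ x → ThreeRowHook (suc (suc x + p)) (suc x) c p (suc q)) (+-suc c q) ih

threeRow-row₁-blocked : ∀ c p → let b1 = suc c + 0 ; b = suc b1 ; a = suc (b + p) in
  viaRow₁ a b (suc c) * (a ! * b1 ! * (suc c) ! * sums a b1 (suc c)) ≡ (a + b1 + suc c) ! * (suc (suc p) * (suc (suc p) + 0) * 0)
threeRow-row₁-blocked c p
  rewrite viaRow₁-blocked (suc (suc (suc c + 0) + p)) (suc c + 0) (suc c) z<s (s≤s (≤-reflexive (+-identityʳ c)))
  = zero-right ((suc (suc (suc c + 0) + p) + (suc c + 0) + suc c) !) (suc (suc p) * (suc (suc p) + 0))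
  where zero-right : ∀ x y → 0 ≡ x * (y * 0)
        zero-right = solve-∀

threeRow-row₁-corner : ∀ c q p → ThreeRowHook (suc (suc (suc c + q) + suc p)) (suc (suc c + q)) (suc c) (suc p) q →
  let b1 = suc c + suc q ; b = suc b1 ; a = suc (b + p) in
  viaRow₁ a b (suc c) * (a ! * b1 ! * (suc c) ! * sums a b1 (suc c)) ≡ (a + b1 + suc c) ! * (suc (suc p) * (suc (suc p) + suc q) * suc q)
threeRow-row₁-corner c q p ih
  rewrite viaRow₁-corner (suc (suc (suc c + suc q) + p)) (suc c + suc q) (suc c) (inj₂ (s≤s (≤-trans (s≤s (m≤m+n c q)) (≤-reflexive (sym (+-suc c q))))))
  = subst₂ (λ x y → ThreeRowHook x y (suc c) (suc p) q) a≡ b≡ ih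
  where
  b≡ : suc (suc c + q) ≡ suc c + suc q
  b≡ = cong suc (sym (+-suc c q))
  a≡ : suc (suc (suc c + q) + suc p) ≡ suc (suc (suc c + suc q) + p)
  a≡ = cong suc (trans (+-suc (suc (suc c + q)) p) (cong (λ z → suc z + p) b≡))

threeRow-row₀-blocked : ∀ c q → let b = suc (suc c + q) ; a1 = b + 0 in
  viaRow₀ (suc a1) b (suc c) * (a1 ! * b ! * (suc c) ! * sums a1 b (suc c)) ≡ (a1 + b + suc c) ! * (0 * (0 + suc q) * suc q)
threeRow-row₀-blocked c q
  rewrite viaRow₀-blocked (suc (suc c + q) + 0) (suc (suc c + q)) (suc c) (inj₁ (z<s , ≤-reflexive (+-identityʳ _)))
  = sym (*-zeroʳ (((suc (suc c + q) + 0) + suc (suc c + q) + suc c) !))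

threeRow-row₀-corner : ∀ c q p → ThreeRowHook (suc (suc (suc c + q) + p)) (suc (suc c + q)) (suc c) p q →
  let b = suc (suc c + q) ; a1 = b + suc p in
  viaRow₀ (suc a1) b (suc c) * (a1 ! * b ! * (suc c) ! * sums a1 b (suc c)) ≡ (a1 + b + suc c) ! * (suc p * (suc p + suc q) * suc q)
threeRow-row₀-corner c q p ih
  rewrite viaRow₀-corner (suc (suc c + q) + suc p) (suc (suc c + q)) (suc c) (inj₂ (m<m+n (suc (suc c + q)) z<s)
   , inj₂ (≤-trans (s≤s (s≤s (s≤s (m≤m+n c q)))) (≤-trans (s≤s (m≤m+n (suc (suc c + q)) p)) (≤-reflexive (sym (+-suc (suc (suc c + q)) p))))))
  = subst (λ x → ThreeRowHook x (suc (suc c + q)) (suc c) p q) (sym (+-suc (suc (suc c + q)) p)) ih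

-- The formula, by induction along the recursion: row 0 lowers p, row 1 trades q
-- for p, and row 2 lowers c.
threeRowHook : ∀ c q p → ThreeRowHook (suc (suc (c + q) + p)) (suc (c + q)) c p q
threeRowHook zero q p = threeRow-base p q
threeRowHook (suc c) zero zero = threeRow-step 0 0 c
  (threeRow-row₀-blocked c 0)
  (threeRow-row₁-blocked c 0)
  (threeRow-row₂ c 0 0 (threeRowHook c 1 0))
threeRowHook (suc c) zero (suc p) = threeRow-step (suc p) 0 c
  (threeRow-row₀-corner c 0 p (threeRowHook (suc c) 0 p))
  (threeRow-row₁-blocked c (suc p))
  (threeRow-row₂ c 0 (suc p) (threeRowHook c 1 (suc p)))
threeRowHook (suc c) (suc q) zero = threeRow-step 0 (suc q) c
  (threeRow-row₀-blocked c (suc q))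
  (threeRow-row₁-corner c q 0 (threeRowHook (suc c) q 1))
  (threeRow-row₂ c (suc q) 0 (threeRowHook c (suc (suc q)) 0))
threeRowHook (suc c) (suc q) (suc p) = threeRow-step (suc p) (suc q) c
  (threeRow-row₀-corner c (suc q) p (threeRowHook (suc c) (suc q) p))
  (threeRow-row₁-corner c q (suc p) (threeRowHook (suc c) q (suc (suc p))))
  (threeRow-row₂ c (suc q) (suc p) (threeRowHook c (suc (suc q)) (suc p)))

Σ≤ : ℕ → (ℕ → ℕ) → ℕ
Σ≤ zero f = f 0
Σ≤ (suc m) f = Σ≤ m f + f (suc m)

Σ≤-cong : ∀ m {f h : ℕ → ℕ} → (∀ c → c ≤ m → f c ≡ h c) → Σ≤ m f ≡ Σ≤ m h
Σ≤-cong zero same = same 0 z≤n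
Σ≤-cong (suc m) same = cong₂ _+_ (Σ≤-cong m (λ c c≤m → same c (m≤n⇒m≤1+n c≤m))) (same (suc m) ≤-refl)

Σ≤-+ : ∀ m (f h : ℕ → ℕ) → Σ≤ m (λ c → f c + h c) ≡ Σ≤ m f + Σ≤ m h
Σ≤-+ zero f h = refl
Σ≤-+ (suc m) f h = trans (cong (_+ (f (suc m) + h (suc m))) (Σ≤-+ m f h)) (regroup (Σ≤ m f) (Σ≤ m h) (f (suc m)) (h (suc m)))
  where
  regroup : ∀ a b c d → a + b + (c + d) ≡ a + c + (b + d)
  regroup = solve-∀

-- Square shapes.  In the shape (n, n, c) the last box of row 0 is blocked, so the
-- largest entry ends row 1 (possible only while row 2 is shorter) or row 2.
cnt-square-upTo : ∀ r c → cnt (suc (suc r)) (suc (suc r)) c ≡ Σ≤ c (λ c′ → when (c′ <? suc r) (cnt (suc (suc r)) (suc r) c′))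
cnt-square-upTo r zero = begin
    viaRow₀ (suc (suc r)) (suc (suc r)) 0 + viaRow₁ (suc (suc r)) (suc (suc r)) 0 + 0
  ≡⟨ cong₂ (λ x y → x + y + 0) (viaRow₀-blocked (suc r) (suc (suc r)) 0 (inj₁ (z<s , n≤1+n _))) (viaRow₁-shorter (suc (suc r)) r 0) ⟩
    when (0 <? suc r) (cnt (suc (suc r)) (suc r) 0) + 0
  ≡⟨ +-identityʳ _ ⟩
    when (0 <? suc r) (cnt (suc (suc r)) (suc r) 0) ∎
  where open ≡-Reasoning
cnt-square-upTo r (suc c) = begin
    viaRow₀ (suc (suc r)) (suc (suc r)) (suc c) + viaRow₁ (suc (suc r)) (suc (suc r)) (suc c) + cnt (suc (suc r)) (suc (suc r)) c
  ≡⟨ cong₂ (λ x y → x + y + cnt (suc (suc r)) (suc (suc r)) c)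
       (viaRow₀-blocked (suc r) (suc (suc r)) (suc c) (inj₁ (z<s , n≤1+n _))) (viaRow₁-shorter (suc (suc r)) r (suc c)) ⟩
    when (suc c <? suc r) (cnt (suc (suc r)) (suc r) (suc c)) + cnt (suc (suc r)) (suc (suc r)) c
  ≡⟨ +-comm (when (suc c <? suc r) (cnt (suc (suc r)) (suc r) (suc c))) (cnt (suc (suc r)) (suc (suc r)) c) ⟩
    cnt (suc (suc r)) (suc (suc r)) c + when (suc c <? suc r) (cnt (suc (suc r)) (suc r) (suc c))
  ≡⟨ cong (_+ when (suc c <? suc r) (cnt (suc (suc r)) (suc r) (suc c))) (cnt-square-upTo r c) ⟩
    Σ≤ (suc c) (λ c′ → when (c′ <? suc r) (cnt (suc (suc r)) (suc r) c′)) ∎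
  where open ≡-Reasoning

-- In the full square shape also the last box of row 1 is blocked.
cnt-square : ∀ r → cnt (suc (suc r)) (suc (suc r)) (suc (suc r)) ≡ Σ≤ (suc r) (λ c → when (c <? suc r) (cnt (suc (suc r)) (suc r) c))
cnt-square r = begin
    viaRow₀ (suc (suc r)) (suc (suc r)) (suc (suc r)) + viaRow₁ (suc (suc r)) (suc (suc r)) (suc (suc r)) + cnt (suc (suc r)) (suc (suc r)) (suc r)
  ≡⟨ cong₂ (λ x y → x + y + cnt (suc (suc r)) (suc (suc r)) (suc r))
       (viaRow₀-blocked (suc r) (suc (suc r)) (suc (suc r)) (inj₁ (z<s , n≤1+n _)))
       (viaRow₁-blocked (suc (suc r)) (suc r) (suc (suc r)) z<s (n≤1+n _)) ⟩
    cnt (suc (suc r)) (suc (suc r)) (suc r)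
  ≡⟨ cnt-square-upTo r (suc r) ⟩
    Σ≤ (suc r) (λ c → when (c <? suc r) (cnt (suc (suc r)) (suc r) c)) ∎
  where open ≡-Reasoning

term : ℕ → ℕ → ℕ
term n1 c = cnt (suc (suc n1)) (suc n1) c + when (c <? n1) (cnt (suc n1) n1 c)

partialSum : ℕ → ℕ → ℕ
partialSum n1 m = Σ≤ m (term n1)

cnt-squares-as-sum : ∀ r → cnt (3 + r) (3 + r) (3 + r) + cnt (2 + r) (2 + r) (2 + r) ≡ partialSum (suc r) (suc r)
cnt-squares-as-sum r = begin
    cnt (3 + r) (3 + r) (3 + r) + cnt (2 + r) (2 + r) (2 + r)
  ≡⟨ cong₂ _+_ (cnt-square (suc r)) (cnt-square r) ⟩
    Σ≤ (suc r) longer + longer (suc (suc r)) + Σ≤ (suc r) shorter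
  ≡⟨ cong (λ x → Σ≤ (suc r) longer + x + Σ≤ (suc r) shorter) (when-no (suc (suc r) <? suc (suc r)) (<-irrefl refl)) ⟩
    Σ≤ (suc r) longer + 0 + Σ≤ (suc r) shorter
  ≡⟨ cong (_+ Σ≤ (suc r) shorter) (trans (+-identityʳ _) (Σ≤-cong (suc r) (λ c c≤ → when-yes (c <? suc (suc r)) (s≤s c≤)))) ⟩
    Σ≤ (suc r) (cnt (3 + r) (2 + r)) + Σ≤ (suc r) shorter
  ≡⟨ Σ≤-+ (suc r) (cnt (3 + r) (2 + r)) shorter ⟨
    partialSum (suc r) (suc r) ∎
  where
  open ≡-Reasoning
  longer shorter : ℕ → ℕ
  longer c = when (c <? suc (suc r)) (cnt (3 + r) (2 + r) c)
  shorter c = when (c <? suc r) (cnt (2 + r) (1 + r) c)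

-- Closed form of the partial sums (a Gosper-type certificate).  With n1 = m + k,
--   2 · partialSum n1 m · denominator n1 m (n1!) (m!) = gosper m k · (2n1 + m + 2)!.
-- gosper is a polynomial of degree 6; the identities below are checked by
-- normalisation and encode "closed form at m" + "summand m+1" = "closed form at m+1".
gosper : ℕ → ℕ → ℕ
gosper m k = (48 + 236 * k + 472 * k * k + 491 * k * k * k + 280 * k * k * k * k + 83 * k * k * k * k * k + 10 * k * k * k * k * k * k + 234 * m + 881 * m * k + 1306 * m * k * k + 952 * m * k * k * k + 341 * m * k * k * k * k + 48 * m * k * k * k * k * k + 408 * m * m + 1119 * m * m * k + 1139 * m * m * k * k + 512 * m * m * k * k * k + 86 * m * m * k * k * k * k + 306 * m * m * m + 550 * m * m * m * k + 330 * m * m * m * k * k + 68 * m * m * m * k * k * k + 84 * m * m * m * m + 76 * m * m * m * m * k + 20 * m * m * m * m * k * k)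

denominator : ℕ → ℕ → ℕ → ℕ → ℕ
denominator n1 m f1 f2 = (suc n1 + n1) * (suc n1 + suc n1 + 1) * (suc n1 * suc n1 * suc n1) * ((suc n1 + 1) * (suc n1 + 1)) * (f1 * f1) * f2 * (suc n1 + m) * (suc n1 + m + 1)

ClosedForm : ℕ → ℕ → ℕ → Set
ClosedForm n1 m k = 2 * partialSum n1 m * denominator n1 m (n1 !) (m !) ≡ gosper m k * (suc n1 + suc n1 + m) !

step-regroup : ∀ n1 m G s1 s2 f1 f2 →
  2 * (G + (s1 + s2)) * ((suc n1 + n1) * (suc n1 + suc n1 + 1) * (suc n1 * suc n1 * suc n1) * ((suc n1 + 1) * (suc n1 + 1)) * (f1 * f1) * (suc m * f2) * (suc n1 + suc m) * (suc n1 + suc m + 1)) * (suc n1 + m)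
  ≡ suc m * (suc n1 + suc (suc m)) * (2 * G * ((suc n1 + n1) * (suc n1 + suc n1 + 1) * (suc n1 * suc n1 * suc n1) * ((suc n1 + 1) * (suc n1 + 1)) * (f1 * f1) * f2 * (suc n1 + m) * (suc n1 + m + 1)))
    + 2 * (suc n1 + n1) * suc n1 * (suc n1 + 1) * (suc n1 + m) * (s1 * ((suc (suc n1) * (suc n1 * f1)) * (suc n1 * f1) * (suc m * f2) * ((suc (suc n1) + suc n1) * (suc (suc n1) + suc m) * (suc n1 + suc m))))
    + 2 * (suc n1 + suc n1 + 1) * (suc n1 * suc n1) * ((suc n1 + 1) * (suc n1 + 1)) * (suc n1 + suc (suc m)) * (s2 * ((suc n1 * f1) * f1 * (suc m * f2) * ((suc n1 + n1) * (suc n1 + suc m) * (n1 + suc m))))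
step-regroup = solve-∀

step-certificate : ∀ m k f3 →
  suc m * ((suc (suc (m + k))) + suc (suc m)) * ((48 + 236 * (suc k) + 472 * (suc k) * (suc k) + 491 * (suc k) * (suc k) * (suc k) + 280 * (suc k) * (suc k) * (suc k) * (suc k) + 83 * (suc k) * (suc k) * (suc k) * (suc k) * (suc k) + 10 * (suc k) * (suc k) * (suc k) * (suc k) * (suc k) * (suc k) + 234 * m + 881 * m * (suc k) + 1306 * m * (suc k) * (suc k) + 952 * m * (suc k) * (suc k) * (suc k) + 341 * m * (suc k) * (suc k) * (suc k) * (suc k) + 48 * m * (suc k) * (suc k) * (suc k) * (suc k) * (suc k) + 408 * m * m + 1119 * m * m * (suc k) + 1139 * m * m * (suc k) * (suc k) + 512 * m * m * (suc k) * (suc k) * (suc k) + 86 * m * m * (suc k) * (suc k) * (suc k) * (suc k) + 306 * m * m * m + 550 * m * m * m * (suc k) + 330 * m * m * m * (suc k) * (suc k) + 68 * m * m * m * (suc k) * (suc k) * (suc k) + 84 * m * m * m * m + 76 * m * m * m * m * (suc k) + 20 * m * m * m * m * (suc k) * (suc k)) * f3)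
  + 2 * ((suc (suc (m + k))) + (suc (m + k))) * (suc (suc (m + k))) * ((suc (suc (m + k))) + 1) * ((suc (suc (m + k))) + m) * ((suc (suc ((suc (suc (m + k))) + (suc (suc (m + k))) + m)) * (suc ((suc (suc (m + k))) + (suc (suc (m + k))) + m) * f3)) * (suc 0 * (suc 0 + suc k) * suc k))
  + 2 * ((suc (suc (m + k))) + (suc (suc (m + k))) + 1) * ((suc (suc (m + k))) * (suc (suc (m + k)))) * (((suc (suc (m + k))) + 1) * ((suc (suc (m + k))) + 1)) * ((suc (suc (m + k))) + suc (suc m)) * (f3 * (suc k * k))
  ≡ (48 + 236 * k + 472 * k * k + 491 * k * k * k + 280 * k * k * k * k + 83 * k * k * k * k * k + 10 * k * k * k * k * k * k + 234 * (suc m) + 881 * (suc m) * k + 1306 * (suc m) * k * k + 952 * (suc m) * k * k * k + 341 * (suc m) * k * k * k * k + 48 * (suc m) * k * k * k * k * k + 408 * (suc m) * (suc m) + 1119 * (suc m) * (suc m) * k + 1139 * (suc m) * (suc m) * k * k + 512 * (suc m) * (suc m) * k * k * k + 86 * (suc m) * (suc m) * k * k * k * k + 306 * (suc m) * (suc m) * (suc m) + 550 * (suc m) * (suc m) * (suc m) * k + 330 * (suc m) * (suc m) * (suc m) * k * k + 68 * (suc m) * (suc m) * (suc m) * k * k * k + 84 * (suc m) * (suc m) * (suc m) * (suc m) + 76 * (suc m) * (suc m) * (suc m) * (suc m) * k + 20 * (suc m) * (suc m) * (suc m) * (suc m) * k * k) * (suc ((suc (suc (m + k))) + (suc (suc (m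 + k))) + m) * f3) * ((suc (suc (m + k))) + m)
step-certificate = solve-∀

closedForm-step : ∀ m k G s1 s2 f1 f2 f3 →
  2 * G * denominator (suc (m + k)) m f1 f2 ≡ gosper m (suc k) * f3 →
  s1 * ((suc (suc (suc (m + k))) * (suc (suc (m + k)) * f1)) * (suc (suc (m + k)) * f1) * (suc m * f2) * ((suc (suc (suc (m + k))) + suc (suc (m + k))) * (suc (suc (suc (m + k))) + suc m) * (suc (suc (m + k)) + suc m))) ≡ (suc (suc (suc (suc (m + k)) + suc (suc (m + k)) + m)) * (suc (suc (suc (m + k)) + suc (suc (m + k)) + m) * f3)) * (suc 0 * (suc 0 + suc k) * suc k) →
  s2 * ((suc (suc (m + k)) * f1) * f1 * (suc m * f2) * ((suc (suc (m + k)) + suc (m + k)) * (suc (suc (m + k)) + suc m) * (suc (m + k) + suc m))) ≡ f3 * (suc k * k) →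
  2 * (G + (s1 + s2)) * denominator (suc (m + k)) (suc m) f1 (suc m * f2) ≡ gosper (suc m) k * (suc (suc (suc (m + k)) + suc (suc (m + k)) + m) * f3)
closedForm-step m k G s1 s2 f1 f2 f3 closed hook₁ hook₂ = *-cancelʳ-≡ _ _ (suc (suc (m + k)) + m)
  (trans (step-regroup (suc (m + k)) m G s1 s2 f1 f2)
  (trans (cong₂ _+_ (cong₂ _+_ (cong (suc m * (suc (suc (m + k)) + suc (suc m)) *_) closed) (cong (2 * (suc (suc (m + k)) + suc (m + k)) * suc (suc (m + k)) * (suc (suc (m + k)) + 1) * (suc (suc (m + k)) + m) *_) hook₁)) (cong (2 * (suc (suc (m + k)) + suc (suc (m + k)) + 1) * (suc (suc (m + k)) * suc (suc (m + k))) * ((suc (suc (m + k)) + 1) * (suc (suc (m + k)) + 1)) * (suc (suc (m + k)) + suc (suc m)) *_) hook₂))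
  (step-certificate m k f3)))

base-regroup : ∀ k s1 s2 f1 →
  2 * (s1 + s2) * (((suc (suc k)) + (suc k)) * ((suc (suc k)) + (suc (suc k)) + 1) * ((suc (suc k)) * (suc (suc k)) * (suc (suc k))) * (((suc (suc k)) + 1) * ((suc (suc k)) + 1)) * (f1 * f1) * 1 * ((suc (suc k)) + 0) * ((suc (suc k)) + 0 + 1)) * suc k
  ≡ 2 * ((suc (suc k)) + (suc k)) * (suc (suc k)) * ((suc (suc k)) + 1) * suc k * (s1 * ((suc (suc (suc k)) * ((suc (suc k)) * f1)) * ((suc (suc k)) * f1) * 1 * ((suc (suc (suc k)) + (suc (suc k))) * (suc (suc (suc k)) + 0) * ((suc (suc k)) + 0))))
    + 2 * ((suc (suc k)) + (suc (suc k)) + 1) * ((suc (suc k)) * (suc (suc k))) * (((suc (suc k)) + 1) * ((suc (suc k)) + 1) * ((suc (suc k)) + 1)) * (s2 * (((suc (suc k)) * f1) * f1 * 1 * (((suc (suc k)) + (suc k)) * ((suc (suc k)) + 0) * ((suc k) + 0))))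
base-regroup = solve-∀

base-certificate : ∀ k F →
  2 * ((suc (suc k)) + (suc k)) * (suc (suc k)) * ((suc (suc k)) + 1) * suc k * ((suc (suc ((suc (suc k)) + (suc k))) * (suc ((suc (suc k)) + (suc k)) * F)) * (suc 0 * (suc 0 + suc (suc k)) * suc (suc k)))
    + 2 * ((suc (suc k)) + (suc (suc k)) + 1) * ((suc (suc k)) * (suc (suc k))) * (((suc (suc k)) + 1) * ((suc (suc k)) + 1) * ((suc (suc k)) + 1)) * (F * (suc 0 * (suc 0 + suc k) * suc k))
  ≡ (48 + 236 * (suc k) + 472 * (suc k) * (suc k) + 491 * (suc k) * (suc k) * (suc k) + 280 * (suc k) * (suc k) * (suc k) * (suc k) + 83 * (suc k) * (suc k) * (suc k) * (suc k) * (suc k) + 10 * (suc k) * (suc k) * (suc k) * (suc k) * (suc k) * (suc k) + 234 * 0 + 881 * 0 * (suc k) + 1306 * 0 * (suc k) * (suc k) + 952 * 0 * (suc k) * (suc k) * (suc k) + 341 * 0 * (suc k) * (suc k) * (suc k) * (suc k) + 48 * 0 * (suc k) * (suc k) * (suc k) * (suc k) * (suc k) + 408 * 0 * 0 + 1119 * 0 * 0 * (suc k) + 1139 * 0 * 0 * (suc k) * (suc k) + 512 * 0 * 0 * (suc k) * (suc k) * (suc k) + 86 * 0 * 0 * (suc k) * (suc k) * (suc k) * (suc k) + 306 * 0 * 0 * 0 + 550 * 0 * 0 * 0 * (suc k) + 330 * 0 * 0 * 0 * (suc k) * (suc k) + 68 * 0 * 0 * 0 * (suc k) * (suc k) * (suc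 k) + 84 * 0 * 0 * 0 * 0 + 76 * 0 * 0 * 0 * 0 * (suc k) + 20 * 0 * 0 * 0 * 0 * (suc k) * (suc k)) * (suc ((suc (suc k)) + (suc k)) * F) * suc k
base-certificate = solve-∀

closedForm-base : ∀ k → ClosedForm (suc k) 0 (suc k)
closedForm-base k = trans (*-cancelʳ-≡ _ _ (suc k) (trans (base-regroup k s1 s2 f1) (trans (cong₂ _+_ (cong (2 * (n + suc k) * n * (n + 1) * suc k *_) longer-hook) (cong (2 * (n + n + 1) * (n * n) * ((n + 1) * (n + 1) * (n + 1)) *_) shorter-hook)) (base-certificate k F))))
                (cong (λ z → gosper 0 (suc k) * z !) (sym (size₂ k)))
  where
  n s1 s2 f1 F : ℕ
  n = suc (suc k)
  s1 = cnt (suc n) n 0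
  s2 = cnt n (suc k) 0
  f1 = (suc k) !
  F = (n + suc k) !
  size₁ : ∀ k → suc (suc (suc k)) + suc (suc k) + 0 ≡ suc (suc (suc (suc k) + suc k))
  size₁ = solve-∀
  size₂ : ∀ k → suc (suc k) + suc (suc k) + 0 ≡ suc (suc (suc k) + suc k)
  size₂ = solve-∀
  longer-hook : s1 * ((suc n * (n * f1)) * (n * f1) * 1 * ((suc n + n) * (suc n + 0) * (n + 0))) ≡ (suc (suc (n + suc k)) * (suc (n + suc k) * F)) * (suc 0 * (suc 0 + suc (suc k)) * suc (suc k))
  longer-hook = trans (subst (λ x → ThreeRowHook (suc x) n 0 0 (suc k)) (+-identityʳ n) (threeRowHook 0 (suc k) 0)) (cong (λ z → z ! * diffs 0 (suc k)) (size₁ k))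
  shorter-hook : s2 * ((n * f1) * f1 * 1 * ((n + suc k) * (n + 0) * (suc k + 0))) ≡ F * (suc 0 * (suc 0 + suc k) * suc k)
  shorter-hook = trans (subst (λ x → ThreeRowHook (suc x) (suc k) 0 0 k) (+-identityʳ (suc k)) (threeRowHook 0 k 0)) (cong (λ z → z ! * diffs 0 k) (+-identityʳ (n + suc k)))

shorterWeight : ℕ → ℕ → ℕ
shorterWeight m k = let n1 = suc (m + k) ; n = suc n1 in
  (n * (n1 !)) * (n1 !) * (suc m * m !) * ((n + n1) * (n + suc m) * (n1 + suc m))

shorterTerm : ∀ m k → let n1 = suc (m + k) ; n = suc n1 in
  when (suc m <? n1) (cnt n n1 (suc m)) * shorterWeight m k ≡ (n + n + m) ! * (suc k * k)
shorterTerm m zero = trans (cong (_* shorterWeight m zero) (when-no (suc m <? suc (m + 0)) (λ m<m → <-irrefl (sym (+-identityʳ m)) (≤-pred m<m))))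
                           (sym (*-zeroʳ ((suc (suc (m + 0)) + suc (suc (m + 0)) + m) !)))
shorterTerm m (suc k) = trans (cong (_* shorterWeight m (suc k)) (when-yes (suc m <? suc (m + suc k)) (s≤s (≤-trans (s≤s (m≤m+n m k)) (≤-reflexive (sym (+-suc m k)))))))
  (trans hook (trans (cong (λ z → z ! * diffs 0 k) (sizes m k)) (diffs-0 ((suc (suc (m + suc k)) + suc (suc (m + suc k)) + m) !) k)))
  where
  hook : ThreeRowHook (suc (suc (m + suc k))) (suc (m + suc k)) (suc m) 0 k
  hook = subst (λ x → ThreeRowHook (suc x) (suc (m + suc k)) (suc m) 0 k) (+-identityʳ (suc (m + suc k)))
           (subst (λ x → ThreeRowHook (suc (x + 0)) x (suc m) 0 k) (cong suc (sym (+-suc m k))) (threeRowHook (suc m) k 0))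
  sizes : ∀ m k → suc (suc (m + suc k)) + suc (m + suc k) + suc m ≡ suc (suc (m + suc k)) + suc (suc (m + suc k)) + m
  sizes = solve-∀
  diffs-0 : ∀ F k → F * (suc 0 * (suc 0 + suc k) * suc k) ≡ F * (suc (suc k) * suc k)
  diffs-0 = solve-∀

closedForm : ∀ m k → 1 ≤ m + k → ClosedForm (m + k) m k
closedForm zero (suc k) _ = closedForm-base k
closedForm (suc m) k _ = trans (closedForm-step m k (partialSum n1 m) s1 s2 (n1 !) (m !) ((suc n1 + suc n1 + m) !) previous longer-hook (shorterTerm m k))
                               (cong (λ z → gosper (suc m) k * z !) (sym (+-suc (suc n1 + suc n1) m)))
  where
  n1 n s1 s2 : ℕ
  n1 = suc (m + k)
  n = suc n1
  s1 = cnt (suc n) n (suc m)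
  s2 = when (suc m <? n1) (cnt n n1 (suc m))
  previous : ClosedForm n1 m (suc k)
  previous = subst (λ x → ClosedForm x m (suc k)) (+-suc m k) (closedForm m (suc k) (subst (1 ≤_) (sym (+-suc m k)) (s≤s z≤n)))
  longer-hook : s1 * ((suc n * (n * (n1 !))) * (n * (n1 !)) * (suc m * (m !)) * ((suc n + n) * (suc n + suc m) * (n + suc m)))
       ≡ (suc (suc (n + n + m)) * (suc (n + n + m) * (suc n1 + suc n1 + m) !)) * (suc 0 * (suc 0 + suc k) * suc k)
  longer-hook = trans (subst (λ x → ThreeRowHook (suc x) n (suc m) 0 k) (+-identityʳ n) (threeRowHook (suc m) k 0))
             (cong (λ z → (suc z) ! * diffs 0 k) (+-suc (n + n) m))

binomial-factorials : ∀ a b → ((a + b) C a) * (a ! * b !) ≡ (a + b) !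
binomial-factorials a b with nCk≡n!/k![n-k]! {a + b} {a} (m≤m+n a b) | k![n∸k]!∣n! {a + b} {a} (m≤m+n a b)
... | quotient | divisible rewrite m+n∸m≡n a b = trans (cong (_* (a ! * b !)) quotient) (m/n*n≡m {{a !* b !≢0}} divisible)

module Binomials (r : ℕ) where
  f1 L H C1 C2 : ℕ
  f1 = (suc r) !
  L = (suc r + suc r) !
  H = ((suc (suc r)) + (suc (suc r)) + suc r) !
  C1 = (2 * (suc (suc r)) ∸ 2) C ((suc (suc r)) ∸ 1)
  C2 = (3 * (suc (suc r))) C ((suc (suc r)) ∸ 1)

  central : C1 * (f1 * f1) ≡ L
  central = trans (cong (λ z → (z C suc r) * (f1 * f1)) (double r)) (binomial-factorials (suc r) (suc r))
    where
    double : ∀ r → r + ((suc (suc r)) + 0) ≡ suc r + suc r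
    double = solve-∀

  -- C(3n, n-1) (n-1)! (2n+1)! = (3n)!, with (2n+1)! expanded down to (2n-2)!
  outer : C2 * (f1 * (suc (suc (suc (suc r + suc r))) * (suc (suc (suc r + suc r)) * (suc (suc r + suc r) * L)))) ≡ suc ((suc (suc r)) + (suc (suc r)) + suc r) * H
  outer = trans (cong (λ z → (z C suc r) * (f1 * (suc (suc (suc (suc r + suc r)))) !)) (triple r))
                (trans (binomial-factorials (suc r) (suc (suc (suc (suc r + suc r))))) (cong _! (triple′ r)))
    where
    triple : ∀ r → 3 * (suc (suc r)) ≡ suc r + suc (suc (suc (suc r + suc r)))
    triple = solve-∀
    triple′ : ∀ r → suc r + suc (suc (suc (suc r + suc r))) ≡ suc ((suc (suc r)) + (suc (suc r)) + suc r)
    triple′ = solve-∀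

  poly common : ℕ
  poly = 2 * ((suc (suc r)) + suc r) * ((suc (suc r)) + suc r) * ((suc (suc r)) + (suc (suc r)) + 1) * ((suc (suc r)) + (suc (suc r))) * (suc (suc r))
  common = poly * (f1 * f1 * f1)

  instance
    f1≢0 : NonZero f1
    f1≢0 = (suc r) !≢0
    f1²≢0 : NonZero (f1 * f1)
    f1²≢0 = m*n≢0 f1 f1
    f1³≢0 : NonZero (f1 * f1 * f1)
    f1³≢0 = m*n≢0 (f1 * f1) f1

  common≢0 : NonZero common
  common≢0 = m*n≢0 poly (f1 * f1 * f1)

  lhs-normal : ∀ r G f1 → (suc (suc r)) * (suc (suc r)) * (suc (suc (suc r)) * suc (suc (suc r))) * G * ((2 * ((suc (suc r)) + suc r) * ((suc (suc r)) + suc r) * ((suc (suc r)) + (suc (suc r)) + 1) * ((suc (suc r)) + (suc (suc r))) * (suc (suc r))) * (f1 * f1 * f1)) ≡ 2 * G * (((suc (suc r)) + suc r) * ((suc (suc r)) + (suc (suc r)) + 1) * ((suc (suc r)) * (suc (suc r)) * (suc (suc r))) * (((suc (suc r)) + 1) * ((suc (suc r)) + 1)) * (f1 * f1) * f1 * ((suc (suc r)) + suc r) * ((suc (suc r)) + suc r + 1))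
  lhs-normal = solve-∀
  gosper-at-end : ∀ r H → (48 + 236 * 0 + 472 * 0 * 0 + 491 * 0 * 0 * 0 + 280 * 0 * 0 * 0 * 0 + 83 * 0 * 0 * 0 * 0 * 0 + 10 * 0 * 0 * 0 * 0 * 0 * 0 + 234 * (suc r) + 881 * (suc r) * 0 + 1306 * (suc r) * 0 * 0 + 952 * (suc r) * 0 * 0 * 0 + 341 * (suc r) * 0 * 0 * 0 * 0 + 48 * (suc r) * 0 * 0 * 0 * 0 * 0 + 408 * (suc r) * (suc r) + 1119 * (suc r) * (suc r) * 0 + 1139 * (suc r) * (suc r) * 0 * 0 + 512 * (suc r) * (suc r) * 0 * 0 * 0 + 86 * (suc r) * (suc r) * 0 * 0 * 0 * 0 + 306 * (suc r) * (suc r) * (suc r) + 550 * (suc r) * (suc r) * (suc r) * 0 + 330 * (suc r) * (suc r) * (suc r) * 0 * 0 + 68 * (suc r) * (suc r) * (suc r) * 0 * 0 * 0 + 84 * (suc r) * (suc r) * (suc r) * (suc r) + 76 * (suc r) * (suc r) * (suc r) * (suc r) * 0 + 20 * (suc r) * (suc r) * (suc r) * (suc r) * 0 * 0) * H ≡ (7 * (suc (suc r)) + 1) * (2 * ((suc (suc r)) + suc r) * (suc (suc r))) * (suc ((suc (suc r)) + (suc (suc r)) + suc r) * H)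
  gosper-at-end = solve-∀
  rhs-normal : ∀ r C1 C2 f1 → (7 * (suc (suc r)) + 1) * (2 * ((suc (suc r)) + suc r) * (suc (suc r))) * (C2 * (f1 * (suc (suc (suc (suc r + suc r))) * (suc (suc (suc r + suc r)) * (suc (suc r + suc r) * (C1 * (f1 * f1))))))) ≡ (7 * (suc (suc r)) + 1) * C1 * C2 * ((2 * ((suc (suc r)) + suc r) * ((suc (suc r)) + suc r) * ((suc (suc r)) + (suc (suc r)) + 1) * ((suc (suc r)) + (suc (suc r))) * (suc (suc r))) * (f1 * f1 * f1))
  rhs-normal = solve-∀

  closedForm⇒formula : ∀ G → 2 * G * denominator (suc r) (suc r) f1 f1 ≡ gosper (suc r) 0 * H →
    (suc (suc r)) * (suc (suc r)) * (suc (suc (suc r)) * suc (suc (suc r))) * G ≡ (7 * (suc (suc r)) + 1) * C1 * C2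
  closedForm⇒formula G closed = *-cancelʳ-≡ _ _ common {{common≢0}} (begin
      (suc (suc r)) * (suc (suc r)) * (suc (suc (suc r)) * suc (suc (suc r))) * G * common
    ≡⟨ lhs-normal r G f1 ⟩
      2 * G * denominator (suc r) (suc r) f1 f1
    ≡⟨ closed ⟩
      gosper (suc r) 0 * H
    ≡⟨ gosper-at-end r H ⟩
      (7 * (suc (suc r)) + 1) * (2 * ((suc (suc r)) + suc r) * (suc (suc r))) * (suc ((suc (suc r)) + (suc (suc r)) + suc r) * H)
    ≡⟨ cong ((7 * (suc (suc r)) + 1) * (2 * ((suc (suc r)) + suc r) * (suc (suc r))) *_) outer ⟨
      (7 * (suc (suc r)) + 1) * (2 * ((suc (suc r)) + suc r) * (suc (suc r))) * (C2 * (f1 * (suc (suc (suc (suc r + suc r))) * (suc (suc (suc r + suc r)) * (suc (suc r + suc r) * L)))))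
    ≡⟨ cong (λ z → (7 * (suc (suc r)) + 1) * (2 * ((suc (suc r)) + suc r) * (suc (suc r))) * (C2 * (f1 * (suc (suc (suc (suc r + suc r))) * (suc (suc (suc r + suc r)) * (suc (suc r + suc r) * z)))))) central ⟨
      (7 * (suc (suc r)) + 1) * (2 * ((suc (suc r)) + suc r) * (suc (suc r))) * (C2 * (f1 * (suc (suc (suc (suc r + suc r))) * (suc (suc (suc r + suc r)) * (suc (suc r + suc r) * (C1 * (f1 * f1)))))))
    ≡⟨ rhs-normal r C1 C2 f1 ⟩
      (7 * (suc (suc r)) + 1) * C1 * C2 * common ∎)
    where open ≡-Reasoning

g₃-square : ∀ n → g₃ (suc (suc n)) ≡ cnt (suc (suc n)) (suc (suc n)) (suc (suc n))
g₃-square n = g₃≡cnt (suc (suc n))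

-- The theorem for numbers x = g₃(n+1) and y = g₃(n) kept abstract: were g₃ applied
-- to a concrete number in a type, the type checker would evaluate the brute-force count.
theorem-for : ∀ n → 1 ≤ n → ∀ x y → x ≡ g₃ (suc n) → y ≡ g₃ n →
    (n * n) * (suc n * suc n) * (x + y) ≡ (7 * n + 1) * ((2 * n ∸ 2) C (n ∸ 1)) * ((3 * n) C (n ∸ 1))
theorem-for (suc zero) _ x y x≡ y≡ = cong (λ z → (1 * 1) * (2 * 2) * z) (cong₂ _+_ (trans x≡ (g₃-square zero)) y≡)
theorem-for (suc (suc r)) _ x y x≡ y≡ = begin
    n * n * (suc n * suc n) * (x + y)
  ≡⟨ cong (λ z → n * n * (suc n * suc n) * z) (cong₂ _+_ (trans x≡ (g₃-square (suc r))) (trans y≡ (g₃-square r))) ⟩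
    n * n * (suc n * suc n) * (cnt (suc n) (suc n) (suc n) + cnt n n n)
  ≡⟨ cong (λ z → n * n * (suc n * suc n) * z) (cnt-squares-as-sum r) ⟩
    n * n * (suc n * suc n) * partialSum (suc r) (suc r)
  ≡⟨ Binomials.closedForm⇒formula r (partialSum (suc r) (suc r)) closed ⟩
    (7 * n + 1) * ((2 * n ∸ 2) C (n ∸ 1)) * ((3 * n) C (n ∸ 1)) ∎
  where
  open ≡-Reasoning
  n : ℕ
  n = suc (suc r)
  closed : ClosedForm (suc r) (suc r) 0
  closed = subst (λ n1 → ClosedForm n1 (suc r) 0) (+-identityʳ (suc r)) (closedForm (suc r) 0 (s≤s z≤n))

theorem1 : ∀ (n : ℕ) → 1 ≤ n →
    (n * n) * (suc n * suc n) * (g₃ (suc n) + g₃ n)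
      ≡ (7 * n + 1) * ((2 * n ∸ 2) C (n ∸ 1)) * ((3 * n) C (n ∸ 1))
theorem1 n 1≤n = theorem-for n 1≤n (g₃ (suc n)) (g₃ n) refl refl
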